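{- (a) The basis $\{\widehat{\mathcal B}(q,t)_\alpha\}$ of $\mathsf{NSym}_{\mathbb C(q,t)}$ is multiplicative, i.e. $\widehat{\mathcal B}(q,t)_\alpha\widehat{\mathcal B}(q,t)_\beta=\widehat{\mathcal B}(q,t)_{\alpha\cdot\beta}$ for all compositions $\alpha,\beta$. (b) $\{\widehat{\mathcal B}(q,t)_k:k\ge0\}$ generates $\mathsf{NSym}_{\mathbb C(q,t)}$ as an algebra. (c) For every $k\ge0$, \[ \triangle\widehat{\mathcal B}(q,t)_k=\sum_{A\subseteq[k]}(q+t)^{|c_2(A)|}\,t^{|c_1(A)|}\,\big(\widehat{\mathcal B}(q,t)_{\alpha_A}\otimes\widehat{\mathcal B}(q,t)_{\beta_A}\big), \] and specializing $(q,t)=(1,0)$ and $(q,t)=(-1,1)$ recovers, in $\mathsf{NSym}$, $\triangle H_k=\sum_{i+j=k}H_i\otimes H_j$ and $\triangle\Lambda_k=\sum_{i+j=k}\Lambda_i\otimes\Lambda_j$.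
   Context: $[n]=\{1,\dots,n\}$. Compositions of $n$ correspond to subsets of $[n-1]$ via $\mathrm{set}(\alpha_1,\dots,\alpha_l)=\{\alpha_1,\alpha_1+\alpha_2,\dots,\alpha_1+\dots+\alpha_{l-1}\}$ and inverse $\mathrm{comp}$; $\alpha^c=\mathrm{comp}([n-1]\setminus\mathrm{set}(\alpha))$; $\alpha\cdot\beta$ is concatenation. $\mathsf{NSym}_{\mathbb C(q,t)}$: free associative algebra over $\mathbb C(q,t)$ on $H_1,H_2,\dots$, $H_\alpha=H_{\alpha_1}\cdots H_{\alpha_l}$, $\triangle H_n=\sum_{i+j=n}H_i\otimes H_j$ ($H_0=1$). $\Lambda_\alpha=\sum_{\beta}(-1)^{n-\ell(\beta)}H_\beta$ over compositions $\beta$ of $n=|\alpha|$ with $\mathrm{set}(\alpha)\subseteq\mathrm{set}(\beta)$; $\Lambda_k=\Lambda_{(k)}$. For $I\subseteq[n-1]$, $\mathcal B(q,t)_{\mathrm{comp}(I)}=\sum_{J\subseteq[n-1]:\,I\cup J=[n-1]}q^{|I\setminus J|}t^{|I\cap J|}H_{\mathrm{comp}(J)}$, $\widehat{\mathcal B}(q,t)_\alpha=\mathcal B(q,t)_{\alpha^c}$, $\widehat{\mathcal B}(q,t)_k=\widehat{\mathcal B}(q,t)_{(k)}$ ($\widehat{\mathcal B}(q,t)_0=1$). For $A\subseteq[k]$: $\mathrm{conn}(A)$ is the set of maximal subsets of $A$ of consecutive integers, listed as $A_1,\dots,A_l$ in increasing order of minima; $c_1(A)=\{\max B:B\in\mathrm{conn}(A)\}\setminus\{k\}$,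 $c_2(A)=\{\max B:B\in\mathrm{conn}([k]\setminus A)\}\setminus\{k\}$; $\alpha_A=(|A_1|,\dots,|A_l|)$ and $\beta_A$ is the analogous composition for $[k]\setminus A$ (empty composition if the set is empty). -}

module Defs where

import Level
open import Algebra.Bundles using (CommutativeRing)
open import Data.Nat as ℕ using (ℕ; zero; suc; _∸_; _⊔_; _≤_)
open import Data.Bool using (Bool; true; false; not; _∧_; _∨_; if_then_else_)
open import Data.List using (List; []; _∷_; _++_; map; length; replicate; concatMap; filterᵇ; foldr; upTo; zipWith)
open import Data.Nat.ListAction using (sum)
open import Data.Bool.ListAction using (and)
import Data.List.Properties as LP
open import Data.List.Relation.Unary.All using (All)
open import Data.Product using (_×_; _,_; ∃)
open import Relation.Nullary.Decidable using (⌊_⌋)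

-- Compositions: lists of natural numbers whose parts are all positive.
-- (Lists with zero parts are allowed as *words* H_{a1}...H_{al} with the
-- convention H_0 = 1; see `norm`.)

Comp : Set
Comp = List ℕ

IsComp : Comp → Set
IsComp α = All (λ a → 1 ≤ a) α

_≟C_ : (α β : Comp) → _
_≟C_ = LP.≡-dec ℕ._≟_

norm : Comp → Comp
norm = filterᵇ (λ a → not ⌊ a ℕ.≟ 0 ⌋)

-- Subsets of [m] are encoded as bit lists b_1 … b_m (b_i = true iff i ∈ set).

allBits : ℕ → List (List Bool)
allBits zero = [] ∷ []
allBits (suc m) = concatMap (λ bs → (false ∷ bs) ∷ (true ∷ bs) ∷ []) (allBits m)

countT : List Bool → ℕ
countT [] = 0
countT (true ∷ bs) = suc (countT bs)
countT (false ∷ bs) = countT bs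

-- comp : subsets of [n-1] (bit lists of length n-1) → compositions of n  (n ≥ 1)
compAux : ℕ → List Bool → Comp
compAux acc [] = acc ∷ []
compAux acc (true ∷ bs) = acc ∷ compAux 1 bs
compAux acc (false ∷ bs) = compAux (suc acc) bs

compOf : List Bool → Comp
compOf = compAux 1

-- set : compositions of n (n ≥ 1) → subsets of [n-1] (bit list of length n-1)
setBits : Comp → List Bool
setBits [] = []
setBits (a ∷ []) = replicate (a ∸ 1) false
setBits (a ∷ b ∷ rest) = replicate (a ∸ 1) false ++ (true ∷ setBits (b ∷ rest))

complC : Comp → Comp
complC α = compOf (map not (setBits α))

size : Comp → ℕ
size = sum

subsetB : List Bool → List Bool → Bool
subsetB I J = and (zipWith (λ i j → not i ∨ j) I J)

-- conn(A) for A ⊆ [k]: maximal runs of consecutive elements, as lists of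
-- positions, in increasing order of minima.  Positions start at `i`.

addTo : ℕ → Bool → List (List ℕ) → List (List ℕ)
addTo i true (c ∷ cs) = (i ∷ c) ∷ cs
addTo i _ cs = (i ∷ []) ∷ cs

headTrue : List Bool → Bool
headTrue (true ∷ _) = true
headTrue _ = false

connAux : ℕ → List Bool → List (List ℕ)
connAux i [] = []
connAux i (false ∷ bs) = connAux (suc i) bs
connAux i (true ∷ bs) = addTo i (headTrue bs) (connAux (suc i) bs)

conn : List Bool → List (List ℕ)
conn = connAux 1

maxL : List ℕ → ℕ
maxL = foldr _⊔_ 0

c₁ : List Bool → List ℕ
c₁ A = filterᵇ (λ m → not ⌊ m ℕ.≟ length A ⌋) (map maxL (conn A))

c₂ : List Bool → List ℕ
c₂ A = c₁ (map not A)

αA : List Bool → Comp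
αA A = map length (conn A)

βA : List Bool → Comp
βA A = map length (conn (map not A))

-- NSym over a commutative ring R: elements are finite formal R-linear
-- combinations of words H_{a1}⋯H_{al}; two elements are equal when their
-- coefficients on every composition (after H_0 = 1) agree.

module NSymOver {c ℓ} (R : CommutativeRing c ℓ) where
  open CommutativeRing R renaming (Carrier to K)

  pow : K → ℕ → K
  pow x zero = 1#
  pow x (suc n) = x * pow x n

  NSym : Set c
  NSym = List (K × Comp)

  coeff : NSym → Comp → K
  coeff [] γ = 0#
  coeff ((a , α) ∷ xs) γ = (if ⌊ norm α ≟C γ ⌋ then a else 0#) + coeff xs γ

  _≈N_ : NSym → NSym → Set ℓ
  x ≈N y = ∀ γ → coeff x γ ≈ coeff y γ

  0N 1N : NSym
  0N = []
  1N = (1# , []) ∷ []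

  _+N_ : NSym → NSym → NSym
  _+N_ = _++_

  _·N_ : K → NSym → NSym
  a ·N x = map (λ { (b , β) → (a * b , β) }) x

  _*N_ : NSym → NSym → NSym
  x *N y = concatMap (λ { (a , α) → map (λ { (b , β) → (a * b , α ++ β) }) y }) x

  ΣN : List NSym → NSym
  ΣN = foldr _+N_ 0N

  prodN : List NSym → NSym
  prodN = foldr _*N_ 1N

  H : Comp → NSym
  H α = (1# , α) ∷ []

  Hk : ℕ → NSym
  Hk n = H (n ∷ [])

  T : Set c
  T = List (K × Comp × Comp)

  coeffT : T → Comp → Comp → K
  coeffT [] γ δ = 0#
  coeffT ((a , α , β) ∷ xs) γ δ =
    (if ⌊ norm α ≟C γ ⌋ ∧ ⌊ norm β ≟C δ ⌋ then a else 0#) + coeffT xs γ δ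

  _≈T_ : T → T → Set ℓ
  x ≈T y = ∀ γ δ → coeffT x γ δ ≈ coeffT y γ δ

  1T : T
  1T = (1# , [] , []) ∷ []

  _·T_ : K → T → T
  a ·T x = map (λ { (b , β , δ) → (a * b , β , δ) }) x

  _*T_ : T → T → T
  x *T y = concatMap (λ { (a , α , γ) → map (λ { (b , β , δ) → (a * b , α ++ β , γ ++ δ) }) y }) x

  ΣT : List T → T
  ΣT = foldr _++_ []

  _⊗_ : NSym → NSym → T
  x ⊗ y = concatMap (λ { (a , α) → map (λ { (b , β) → (a * b , α , β) }) y }) x

  △Hk : ℕ → T
  △Hk n = ΣT (map (λ i → Hk i ⊗ Hk (n ∸ i)) (upTo (suc n)))

  △H : Comp → T
  △H α = foldr (λ a acc → △Hk a *T acc) 1T α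

  △ : NSym → T
  △ x = ΣT (map (λ { (a , α) → a ·T △H α }) x)

  Λ : Comp → NSym
  Λ [] = 1N
  Λ α@(_ ∷ _) =
    ΣN (map (λ J → pow (- 1#) (size α ∸ length (compOf J)) ·N H (compOf J))
            (filterᵇ (subsetB (setBits α)) (allBits (length (setBits α)))))

  Λk : ℕ → NSym
  Λk zero = 1N
  Λk (suc n) = Λ (suc n ∷ [])

  𝓑bits : K → K → List Bool → NSym
  𝓑bits q t I =
    ΣN (map (λ J → (pow q (countT (zipWith (λ i j → i ∧ not j) I J))
                    * pow t (countT (zipWith _∧_ I J))) ·N H (compOf J))
            (filterᵇ (λ J → and (zipWith _∨_ I J)) (allBits (length I))))

  𝓑 : K → K → Comp → NSym
  𝓑 q t [] = 1N
  𝓑 q t γ@(_ ∷ _) = 𝓑bits q t (setBits γ)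

  𝓑̂ : K → K → Comp → NSym
  𝓑̂ q t [] = 1N
  𝓑̂ q t α@(_ ∷ _) = 𝓑 q t (complC α)

  𝓑̂k : K → K → ℕ → NSym
  𝓑̂k q t zero = 1N
  𝓑̂k q t (suc n) = 𝓑̂ q t (suc n ∷ [])

  -- subalgebra generated by {𝓑̂_k}: noncommutative polynomials in the generators
  GenPoly : Set c
  GenPoly = List (K × List ℕ)

  evalGen : K → K → GenPoly → NSym
  evalGen q t p = ΣN (map (λ { (a , w) → a ·N prodN (map (𝓑̂k q t) w) }) p)

  Generates : K → K → Set (c Level.⊔ ℓ)
  Generates q t = ∀ (x : NSym) → ∃ λ (p : GenPoly) → evalGen q t p ≈N x

  coprodRHS : K → K → ℕ → T
  coprodRHS q t k =
    ΣT (map (λ A → (pow (q + t) (length (c₂ A)) * pow t (length (c₁ A)))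
                   ·T (𝓑̂ q t (αA A) ⊗ 𝓑̂ q t (βA A)))
            (allBits k))

  sumHH sumΛΛ : ℕ → T
  sumHH k = ΣT (map (λ i → Hk i ⊗ Hk (k ∸ i)) (upTo (suc k)))
  sumΛΛ k = ΣT (map (λ i → Λk i ⊗ Λk (k ∸ i)) (upTo (suc k)))

module Submission where

-- Write 𝓑̂_α as B⟨1⟩(I) = Σ_J w(I,J) H_comp(J), where I is the complement of set(α) and w(I,J) is a
-- product of local weights.  Expanding the first bit of J gives
--   B⟨a⟩(i ∷ I) = w(i,0) B⟨a+1⟩(I) + w(i,1) H_a B⟨1⟩(I),
-- so B⟨a⟩ factorises at every 0 of I, which is (a).  An inclusion–exclusion over J expresses qᵐ H_{m+1}
-- through products of the 𝓑̂_k, which gives (b) when q is invertible.  For (c), the same expansion gives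
-- 𝓑̂ = P ∗ (1 + t 𝓑̂) for the sequence P_n = q^{n-1} H_n, with ∗ the convolution of graded sequences.
-- As △ is an algebra map and △P = P⊗1 + 1⊗P + q (1⊗P) ∗ (P⊗1), the sequence △𝓑̂ is the unique solution
-- of Y = △P ∗ (1 + t Y); splitting the right-hand side by whether 1 ∈ A and peeling off the first run
-- of A shows that it satisfies the same recursion.  The values of 𝓑̂_k at (1,0) and (-1,1) are direct
-- computations, and △Λ_k is then (c) at (q,t) = (-1,1).

open import Defs
import Level
open import Algebra.Bundles using (CommutativeRing)
import Algebra.Properties.Group as GroupProperties
import Algebra.Properties.Ring as RingProperties
import Algebra.Solver.Ring.NaturalCoefficients.Default as NaturalCoefficientSolver
open import Data.Bool using (Bool; true; false; not; _∧_; _∨_; if_then_else_)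
open import Data.Bool.ListAction using (and)
open import Data.Empty using (⊥-elim)
open import Data.List using (List; []; _∷_; _++_; map; concatMap; foldr; filterᵇ; length; replicate; zipWith; upTo; _∷ʳ_)
import Data.List.Properties as LP
import Data.List.Relation.Unary.All as All
open All using (All; []; _∷_)
open import Data.List.Relation.Unary.All.Properties using (++⁺; applyUpTo⁺₁)
open import Data.Nat as ℕ using (ℕ; zero; suc; _∸_; _≤_; z≤n; s≤s)
import Data.Nat.Properties as ℕP
open import Data.Product using (_×_; _,_; proj₁; proj₂; Σ; ∃)
open import Data.Sum using (inj₁; inj₂)
open import Function using (_∘_; id)
open import Relation.Binary.Bundles using (Setoid)
import Relation.Binary.PropositionalEquality as P
open P using (_≡_; _≢_)
import Relation.Binary.Reasoning.Setoid
open import Relation.Nullary.Decidable using (⌊_⌋; yes; no)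

replicate-suc-++ : ∀ {a} {A : Set a} n (x : A) ys → replicate (suc n) x ++ ys ≡ replicate n x ++ x ∷ ys
replicate-suc-++ zero x ys = P.refl
replicate-suc-++ (suc n) x ys = P.cong (x ∷_) (replicate-suc-++ n x ys)

filterᵇ-all : ∀ {a} {A : Set a} (p : A → Bool) → (∀ x → p x ≡ true) → ∀ xs → filterᵇ p xs ≡ xs
filterᵇ-all p h [] = P.refl
filterᵇ-all p h (x ∷ xs) with p x | h x
... | true | _ = P.cong (x ∷_) (filterᵇ-all p h xs)

All-concatMap : ∀ {a b p} {A : Set a} {B : Set b} {Q : B → Set p} (g : A → List B) xs →
  All (λ x → All Q (g x)) xs → All Q (concatMap g xs)
All-concatMap g [] [] = []
All-concatMap g (x ∷ xs) (h ∷ hs) = ++⁺ h (All-concatMap g xs hs)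

allBits-length : ∀ m → All (λ J → length J ≡ m) (allBits m)
allBits-length zero = P.refl ∷ []
allBits-length (suc m) =
  All-concatMap _ (allBits m) (All.map (λ e → P.cong suc e ∷ P.cong suc e ∷ []) (allBits-length m))

countT≤length : ∀ bs → countT bs ≤ length bs
countT≤length [] = z≤n
countT≤length (true ∷ bs) = s≤s (countT≤length bs)
countT≤length (false ∷ bs) = ℕP.m≤n⇒m≤1+n (countT≤length bs)

compAux-nonempty : ∀ a bs → Σ ℕ λ h → Σ Comp λ tl → compAux a bs ≡ h ∷ tl
compAux-nonempty a [] = a , [] , P.refl
compAux-nonempty a (true ∷ bs) = a , compAux 1 bs , P.refl
compAux-nonempty a (false ∷ bs) = compAux-nonempty (suc a) bs

length-compAux : ∀ a bs → length (compAux a bs) ≡ suc (countT bs)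
length-compAux a [] = P.refl
length-compAux a (true ∷ bs) = P.cong suc (length-compAux 1 bs)
length-compAux a (false ∷ bs) = length-compAux (suc a) bs

compAux-isComp : ∀ a bs → IsComp (compAux (suc a) bs)
compAux-isComp a [] = s≤s z≤n ∷ []
compAux-isComp a (true ∷ bs) = s≤s z≤n ∷ compAux-isComp 0 bs
compAux-isComp a (false ∷ bs) = compAux-isComp (suc a) bs

setBits-compAux : ∀ a bs → setBits (compAux (suc a) bs) ≡ replicate a false ++ bs
setBits-compAux a [] = P.sym (LP.++-identityʳ _)
setBits-compAux a (false ∷ bs) = P.trans (setBits-compAux (suc a) bs) (replicate-suc-++ a false bs)
setBits-compAux a (true ∷ bs) with compAux 1 bs | compAux-nonempty 1 bs | setBits-compAux 0 bs
... | .(h ∷ tl) | h , tl , P.refl | ih = P.cong (λ z → replicate a false ++ true ∷ z) ih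

setBits-compOf : ∀ bs → setBits (compOf bs) ≡ bs
setBits-compOf = setBits-compAux 0

setBits-++ : ∀ x α y β → setBits ((x ∷ α) ++ y ∷ β) ≡ setBits (x ∷ α) ++ true ∷ setBits (y ∷ β)
setBits-++ x [] y β = P.refl
setBits-++ x (x' ∷ α) y β =
  P.trans (P.cong (λ z → replicate (x ∸ 1) false ++ true ∷ z) (setBits-++ x' α y β))
          (P.sym (LP.++-assoc (replicate (x ∸ 1) false) (true ∷ setBits (x' ∷ α)) _))

map-not-replicate-++ : ∀ n b bs → map not (replicate n b ++ bs) ≡ replicate n (not b) ++ map not bs
map-not-replicate-++ n b bs = P.trans (LP.map-++ not (replicate n b) bs) (P.cong (_++ map not bs) (LP.map-replicate not n b))

consRun : Bool → List ℕ → List ℕ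
consRun true (n ∷ ns) = suc n ∷ ns
consRun _ ns = 1 ∷ ns

runLengths : List Bool → List ℕ
runLengths [] = []
runLengths (false ∷ bs) = runLengths bs
runLengths (true ∷ bs) = consRun (headTrue bs) (runLengths bs)

map-length-addTo : ∀ i h cs → map length (addTo i h cs) ≡ consRun h (map length cs)
map-length-addTo i true [] = P.refl
map-length-addTo i true (c ∷ cs) = P.refl
map-length-addTo i false cs = P.refl

map-length-connAux : ∀ i bs → map length (connAux i bs) ≡ runLengths bs
map-length-connAux i [] = P.refl
map-length-connAux i (false ∷ bs) = map-length-connAux (suc i) bs
map-length-connAux i (true ∷ bs) =
  P.trans (map-length-addTo i (headTrue bs) (connAux (suc i) bs))
          (P.cong (consRun (headTrue bs)) (map-length-connAux (suc i) bs))

αA≡runLengths : ∀ A → αA A ≡ runLengths A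
αA≡runLengths = map-length-connAux 1

βA≡runLengths : ∀ A → βA A ≡ runLengths (map not A)
βA≡runLengths A = map-length-connAux 1 (map not A)

runLengths-trues-false : ∀ r bs → runLengths (replicate (suc r) true ++ false ∷ bs) ≡ suc r ∷ runLengths bs
runLengths-trues-false zero bs = P.refl
runLengths-trues-false (suc r) bs rewrite runLengths-trues-false r bs = P.refl

runLengths-trues : ∀ r → runLengths (replicate (suc r) true) ≡ suc r ∷ []
runLengths-trues zero = P.refl
runLengths-trues (suc r) rewrite runLengths-trues r = P.refl

runLengths-falses : ∀ n bs → runLengths (replicate n false ++ bs) ≡ runLengths bs
runLengths-falses zero bs = P.refl
runLengths-falses (suc n) bs = runLengths-falses n bs

runEnds : ℕ → List Bool → List ℕ
runEnds i [] = []
runEnds i (false ∷ bs) = runEnds (suc i) bs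
runEnds i (true ∷ bs) = if headTrue bs then runEnds (suc i) bs else i ∷ runEnds (suc i) bs

connAux-true : ∀ j bs → Σ (List ℕ) λ c → Σ (List (List ℕ)) λ cs → connAux j (true ∷ bs) ≡ (j ∷ c) ∷ cs
connAux-true j bs with headTrue bs | connAux (suc j) bs
... | true | [] = [] , [] , P.refl
... | true | c ∷ cs = c , cs , P.refl
... | false | cs = [] , cs , P.refl

map-maxL-connAux : ∀ i bs → map maxL (connAux i bs) ≡ runEnds i bs
map-maxL-connAux i [] = P.refl
map-maxL-connAux i (false ∷ bs) = map-maxL-connAux (suc i) bs
map-maxL-connAux i (true ∷ []) = P.cong (_∷ []) (ℕP.⊔-identityʳ i)
map-maxL-connAux i (true ∷ false ∷ bs) = P.cong₂ _∷_ (ℕP.⊔-identityʳ i) (map-maxL-connAux (suc i) (false ∷ bs))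
map-maxL-connAux i (true ∷ true ∷ bs)
  with connAux (suc i) (true ∷ bs) | connAux-true (suc i) bs | map-maxL-connAux (suc i) (true ∷ bs)
... | .((suc i ∷ c) ∷ cs) | c , cs , P.refl | ih =
  P.trans (P.cong (_∷ map maxL cs) (ℕP.m≤n⇒m⊔n≡n (ℕP.≤-trans (ℕP.n≤1+n i) (ℕP.m≤m⊔n (suc i) (maxL c))))) ih

interiorRunEnds : List Bool → ℕ
interiorRunEnds [] = 0
interiorRunEnds (false ∷ bs) = interiorRunEnds bs
interiorRunEnds (true ∷ []) = 0
interiorRunEnds (true ∷ true ∷ bs) = interiorRunEnds (true ∷ bs)
interiorRunEnds (true ∷ false ∷ bs) = suc (interiorRunEnds bs)

1+m≢m+2+n : ∀ m {n} → suc m ≢ m ℕ.+ suc (suc n)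
1+m≢m+2+n m {n} e = ℕP.m+1+n≢m m (P.sym (ℕP.suc-injective (P.trans e (ℕP.+-suc m (suc n)))))

length-filterᵇ-keep : ∀ {a} {A : Set a} (p : A → Bool) x xs → p x ≡ true →
  length (filterᵇ p (x ∷ xs)) ≡ suc (length (filterᵇ p xs))
length-filterᵇ-keep p x xs px with p x
... | true = P.refl

length-filterᵇ-drop : ∀ {a} {A : Set a} (p : A → Bool) x xs → p x ≡ false →
  length (filterᵇ p (x ∷ xs)) ≡ length (filterᵇ p xs)
length-filterᵇ-drop p x xs px with p x
... | false = P.refl

≢ᵇ-true : ∀ {m n} → m ≢ n → not ⌊ m ℕ.≟ n ⌋ ≡ true
≢ᵇ-true {m} {n} m≢n with m ℕ.≟ n
... | yes m≡n = ⊥-elim (m≢n m≡n)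
... | no _ = P.refl

≢ᵇ-false : ∀ {m n} → m ≡ n → not ⌊ m ℕ.≟ n ⌋ ≡ false
≢ᵇ-false {m} {n} m≡n with m ℕ.≟ n
... | yes _ = P.refl
... | no m≢n = ⊥-elim (m≢n m≡n)

length-filter-runEnds : ∀ j bs {n} → n ≡ j ℕ.+ length bs →
  length (filterᵇ (λ m → not ⌊ m ℕ.≟ n ⌋) (runEnds (suc j) bs)) ≡ interiorRunEnds bs
length-filter-runEnds j [] e = P.refl
length-filter-runEnds j (false ∷ bs) e = length-filter-runEnds (suc j) bs (P.trans e (ℕP.+-suc j (length bs)))
length-filter-runEnds j (true ∷ []) {n} e =
  length-filterᵇ-drop (λ m → not ⌊ m ℕ.≟ n ⌋) (suc j) [] (≢ᵇ-false (P.trans (P.sym (ℕP.+-comm j 1)) (P.sym e)))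
length-filter-runEnds j (true ∷ true ∷ bs) e =
  length-filter-runEnds (suc j) (true ∷ bs) (P.trans e (ℕP.+-suc j (suc (length bs))))
length-filter-runEnds j (true ∷ false ∷ bs) {n} e =
  P.trans (length-filterᵇ-keep (λ m → not ⌊ m ℕ.≟ n ⌋) (suc j) (runEnds (suc (suc j)) (false ∷ bs))
                                (≢ᵇ-true (λ 1+j≡n → 1+m≢m+2+n j (P.trans 1+j≡n e))))
          (P.cong suc (length-filter-runEnds (suc j) (false ∷ bs) (P.trans e (ℕP.+-suc j (suc (length bs))))))

length-c₁ : ∀ A → length (c₁ A) ≡ interiorRunEnds A
length-c₁ A = P.trans (P.cong (λ ends → length (filterᵇ (λ m → not ⌊ m ℕ.≟ length A ⌋) ends)) (map-maxL-connAux 1 A))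
                      (length-filter-runEnds 0 A P.refl)

interiorRunEnds-trues-false : ∀ r bs → interiorRunEnds (replicate (suc r) true ++ false ∷ bs) ≡ suc (interiorRunEnds bs)
interiorRunEnds-trues-false zero bs = P.refl
interiorRunEnds-trues-false (suc r) bs = interiorRunEnds-trues-false r bs

interiorRunEnds-trues : ∀ r → interiorRunEnds (replicate (suc r) true) ≡ 0
interiorRunEnds-trues zero = P.refl
interiorRunEnds-trues (suc r) = interiorRunEnds-trues r

interiorRunEnds-falses : ∀ n bs → interiorRunEnds (replicate n false ++ bs) ≡ interiorRunEnds bs
interiorRunEnds-falses zero bs = P.refl
interiorRunEnds-falses (suc n) bs = interiorRunEnds-falses n bs

module _ {c ℓ} (R : CommutativeRing c ℓ) where

  open CommutativeRing R renaming (Carrier to K)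
  open NSymOver R
  module ≈-Reasoning = Relation.Binary.Reasoning.Setoid setoid
  open RingProperties ring using (-0#≈0#; -‿distribˡ-*; -‿+-comm)
  open GroupProperties +-group using (x∙y⁻¹≈ε⇒x≈y)
  open NaturalCoefficientSolver commutativeSemiring using (solve; _:=_; _:*_; _:+_; con)

  ∑ : ∀ {a} {A : Set a} → (A → K) → List A → K
  ∑ f [] = 0#
  ∑ f (x ∷ xs) = f x + ∑ f xs

  module _ {a} {A : Set a} where

    ∑-++ : (f : A → K) (xs ys : List A) → ∑ f (xs ++ ys) ≈ ∑ f xs + ∑ f ys
    ∑-++ f [] ys = sym (+-identityˡ _)
    ∑-++ f (x ∷ xs) ys = trans (+-congˡ (∑-++ f xs ys)) (sym (+-assoc _ _ _))

    ∑-cong : {f g : A → K} → (∀ x → f x ≈ g x) → ∀ xs → ∑ f xs ≈ ∑ g xs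
    ∑-cong e [] = refl
    ∑-cong e (x ∷ xs) = +-cong (e x) (∑-cong e xs)

    ∑-cong-All : {f g : A → K} → ∀ {xs} → All (λ x → f x ≈ g x) xs → ∑ f xs ≈ ∑ g xs
    ∑-cong-All [] = refl
    ∑-cong-All (e ∷ es) = +-cong e (∑-cong-All es)

    ∑-+ : (f g : A → K) → ∀ xs → ∑ (λ x → f x + g x) xs ≈ ∑ f xs + ∑ g xs
    ∑-+ f g [] = sym (+-identityˡ _)
    ∑-+ f g (x ∷ xs) = begin
      (f x + g x) + ∑ (λ x → f x + g x) xs ≈⟨ +-congˡ (∑-+ f g xs) ⟩
      (f x + g x) + (∑ f xs + ∑ g xs)       ≈⟨ solve 4 (λ a b c d → (a :+ b) :+ (c :+ d) := (a :+ c) :+ (b :+ d)) refl _ _ _ _ ⟩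
      (f x + ∑ f xs) + (g x + ∑ g xs)       ∎
      where
        open ≈-Reasoning

    ∑-*ˡ : (d : K) (f : A → K) → ∀ xs → ∑ (λ x → d * f x) xs ≈ d * ∑ f xs
    ∑-*ˡ d f [] = sym (zeroʳ d)
    ∑-*ˡ d f (x ∷ xs) = trans (+-congˡ (∑-*ˡ d f xs)) (sym (distribˡ d _ _))

    ∑-*ʳ : (d : K) (f : A → K) → ∀ xs → ∑ (λ x → f x * d) xs ≈ ∑ f xs * d
    ∑-*ʳ d f xs = trans (∑-cong (λ x → *-comm _ _) xs) (trans (∑-*ˡ d f xs) (*-comm _ _))

    ∑-zero : {f : A → K} → (∀ x → f x ≈ 0#) → ∀ xs → ∑ f xs ≈ 0#
    ∑-zero e [] = refl
    ∑-zero e (x ∷ xs) = trans (+-cong (e x) (∑-zero e xs)) (+-identityˡ _)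

    ∑-filterᵇ : (f : A → K) (p : A → Bool) → ∀ xs → ∑ f (filterᵇ p xs) ≈ ∑ (λ x → if p x then f x else 0#) xs
    ∑-filterᵇ f p [] = refl
    ∑-filterᵇ f p (x ∷ xs) with p x
    ... | true = +-congˡ (∑-filterᵇ f p xs)
    ... | false = trans (∑-filterᵇ f p xs) (sym (+-identityˡ _))

  module _ {a b} {A : Set a} {B : Set b} where

    ∑-map : (f : B → K) (g : A → B) → ∀ xs → ∑ f (map g xs) ≡ ∑ (f ∘ g) xs
    ∑-map f g [] = P.refl
    ∑-map f g (x ∷ xs) = P.cong (f (g x) +_) (∑-map f g xs)

    ∑-concatMap : (f : B → K) (g : A → List B) → ∀ xs → ∑ f (concatMap g xs) ≈ ∑ (λ x → ∑ f (g x)) xs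
    ∑-concatMap f g [] = refl
    ∑-concatMap f g (x ∷ xs) = trans (∑-++ f (g x) (concatMap g xs)) (+-congˡ (∑-concatMap f g xs))

    ∑-comm : (f : A → B → K) → ∀ xs ys → ∑ (λ x → ∑ (f x) ys) xs ≈ ∑ (λ y → ∑ (λ x → f x y) xs) ys
    ∑-comm f [] ys = sym (∑-zero (λ _ → refl) ys)
    ∑-comm f (x ∷ xs) ys = trans (+-congˡ (∑-comm f xs ys)) (sym (∑-+ (f x) _ ys))

    ∑-*-∑ : (f : A → K) (g : B → K) → ∀ xs ys → ∑ f xs * ∑ g ys ≈ ∑ (λ x → ∑ (λ y → f x * g y) ys) xs
    ∑-*-∑ f g xs ys = trans (sym (∑-*ʳ _ f xs)) (∑-cong (λ x → sym (∑-*ˡ (f x) g ys)) xs)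

  ∑-upTo-reverse : ∀ (h : ℕ → K) k → ∑ h (upTo (suc k)) ≈ ∑ (λ i → h (k ∸ i)) (upTo (suc k))
  ∑-upTo-reverse h zero = refl
  ∑-upTo-reverse h (suc k) = begin
    ∑ h (upTo (suc (suc k)))                          ≡⟨ P.cong (∑ h) (P.sym (LP.upTo-∷ʳ (suc k))) ⟩
    ∑ h (upTo (suc k) ∷ʳ suc k)                       ≈⟨ ∑-++ h (upTo (suc k)) (suc k ∷ []) ⟩
    ∑ h (upTo (suc k)) + (h (suc k) + 0#)             ≈⟨ +-cong (∑-upTo-reverse h k) (+-identityʳ _) ⟩
    ∑ (λ i → h (k ∸ i)) (upTo (suc k)) + h (suc k)    ≈⟨ +-comm _ _ ⟩
    h (suc k) + ∑ (λ i → h (k ∸ i)) (upTo (suc k))    ≡⟨ P.cong (h (suc k) +_) (P.sym (∑-map (λ i → h (suc k ∸ i)) suc (upTo (suc k)))) ⟩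
    h (suc k) + ∑ (λ i → h (suc k ∸ i)) (map suc (upTo (suc k)))
                                                      ≡⟨ P.cong (λ is → h (suc k) + ∑ (λ i → h (suc k ∸ i)) is) (LP.map-upTo suc (suc k)) ⟩
    ∑ (λ i → h (suc k ∸ i)) (upTo (suc (suc k)))      ∎
    where
      open ≈-Reasoning

  𝟙 : Bool → K
  𝟙 b = if b then 1# else 0#

  𝟙-∧ : ∀ b b' → 𝟙 (b ∧ b') ≈ 𝟙 b * 𝟙 b'
  𝟙-∧ true b' = sym (*-identityˡ _)
  𝟙-∧ false b' = sym (zeroˡ _)

  if-then-0≈*𝟙 : ∀ b (a : K) → (if b then a else 0#) ≈ a * 𝟙 b
  if-then-0≈*𝟙 true a = sym (*-identityʳ a)
  if-then-0≈*𝟙 false a = sym (zeroʳ a)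

  pow-cong : ∀ {a b} m → a ≈ b → pow a m ≈ pow b m
  pow-cong zero e = refl
  pow-cong (suc m) e = *-cong e (pow-cong m e)

  pow-* : ∀ a b m → pow a m * pow b m ≈ pow (a * b) m
  pow-* a b zero = *-identityˡ _
  pow-* a b (suc m) =
    trans (solve 4 (λ a b x y → (a :* x) :* (b :* y) := (a :* b) :* (x :* y)) refl a b _ _) (*-congˡ (pow-* a b m))

  pow-1# : ∀ m → pow 1# m ≈ 1#
  pow-1# zero = refl
  pow-1# (suc m) = trans (*-identityˡ _) (pow-1# m)

  pow-+ : ∀ (a : K) m n → pow a (m ℕ.+ n) ≈ pow a m * pow a n
  pow-+ a zero n = sym (*-identityˡ _)
  pow-+ a (suc m) n = trans (*-congˡ (pow-+ a m n)) (sym (*-assoc _ _ _))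

  module FormalSums {w} {W : Set w} (_==_ : W → W → Bool)
                    (==-sound : ∀ {u v} → (u == v) ≡ true → u ≡ v) (==-refl : ∀ u → (u == u) ≡ true) where

    coeffOf : List (K × W) → W → K
    coeffOf zs v = ∑ (λ z → proj₁ z * 𝟙 (proj₂ z == v)) zs

    evaluate : (W → K) → List (K × W) → K
    evaluate Φ zs = ∑ (λ z → proj₁ z * Φ (proj₂ z)) zs

    without : W → List (K × W) → List (K × W)
    without v = filterᵇ (λ z → not (proj₂ z == v))

    evaluate-without : ∀ Φ v zs → evaluate Φ zs ≈ coeffOf zs v * Φ v + evaluate Φ (without v zs)
    evaluate-without Φ v [] = sym (trans (+-identityʳ _) (zeroˡ _))
    evaluate-without Φ v ((a , x) ∷ zs) with x == v in x==v
    ... | true = begin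
      a * Φ x + evaluate Φ zs                                  ≈⟨ +-cong (*-congˡ (reflexive (P.cong Φ (==-sound x==v)))) (evaluate-without Φ v zs) ⟩
      a * Φ v + (coeffOf zs v * Φ v + evaluate Φ (without v zs))
        ≈⟨ solve 4 (λ a φ c e → a :* φ :+ (c :* φ :+ e) := (a :* con 1 :+ c) :* φ :+ e) refl a (Φ v) _ _ ⟩
      (a * 1# + coeffOf zs v) * Φ v + evaluate Φ (without v zs) ∎
      where
        open ≈-Reasoning
    ... | false = begin
      a * Φ x + evaluate Φ zs                                  ≈⟨ +-congˡ (evaluate-without Φ v zs) ⟩
      a * Φ x + (coeffOf zs v * Φ v + evaluate Φ (without v zs))
        ≈⟨ solve 5 (λ a φ c ψ e → a :* φ :+ (c :* ψ :+ e) := (a :* con 0 :+ c) :* ψ :+ (a :* φ :+ e)) refl a (Φ x) _ (Φ v) _ ⟩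
      (a * 0# + coeffOf zs v) * Φ v + (a * Φ x + evaluate Φ (without v zs)) ∎
      where
        open ≈-Reasoning

    coeffOf-without-self : ∀ v zs → coeffOf (without v zs) v ≈ 0#
    coeffOf-without-self v [] = refl
    coeffOf-without-self v ((a , x) ∷ zs) with x == v in x==v
    ... | true = coeffOf-without-self v zs
    ... | false rewrite x==v = trans (+-cong (zeroʳ a) (coeffOf-without-self v zs)) (+-identityˡ _)

    coeffOf-without-other : ∀ v u zs → (v == u) ≡ false → coeffOf (without v zs) u ≈ coeffOf zs u
    coeffOf-without-other v u [] v≠u = refl
    coeffOf-without-other v u ((a , x) ∷ zs) v≠u with x == v in x==v
    ... | false = +-congˡ (coeffOf-without-other v u zs v≠u)
    ... | true rewrite ==-sound x==v | v≠u =
      trans (coeffOf-without-other v u zs v≠u) (sym (trans (+-congʳ (zeroʳ a)) (+-identityˡ _)))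

    evaluate-zero : ∀ n zs → length zs ≤ n → (∀ v → coeffOf zs v ≈ 0#) → ∀ Φ → evaluate Φ zs ≈ 0#
    evaluate-zero n [] _ _ Φ = refl
    evaluate-zero (suc n) (z ∷ zs) (s≤s |zs|≤n) coeffs≈0 Φ = begin
      evaluate Φ (z ∷ zs)                                   ≈⟨ evaluate-without Φ v (z ∷ zs) ⟩
      coeffOf (z ∷ zs) v * Φ v + evaluate Φ (without v (z ∷ zs))
        ≈⟨ +-cong (trans (*-congʳ (coeffs≈0 v)) (zeroˡ _)) (evaluate-zero n (without v (z ∷ zs)) |rest|≤n rest≈0 Φ) ⟩
      0# + 0#                                               ≈⟨ +-identityˡ _ ⟩
      0#                                                    ∎
      where
      open ≈-Reasoning
      v = proj₂ z
      |rest|≤n : length (without v (z ∷ zs)) ≤ n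
      |rest|≤n rewrite ==-refl v = ℕP.≤-trans (LP.length-filter _ zs) |zs|≤n
      rest≈0 : ∀ u → coeffOf (without v (z ∷ zs)) u ≈ 0#
      rest≈0 u with v == u in v==u
      ... | true = P.subst (λ u → coeffOf (without v (z ∷ zs)) u ≈ 0#) (==-sound v==u) (coeffOf-without-self v (z ∷ zs))
      ... | false = trans (coeffOf-without-other v u (z ∷ zs) v==u) (coeffs≈0 u)

    negate : List (K × W) → List (K × W)
    negate = map (λ z → (- proj₁ z , proj₂ z))

    ∑-negate : (f : W → K) (zs : List (K × W)) →
      ∑ (λ z → proj₁ z * f (proj₂ z)) (negate zs) ≈ - ∑ (λ z → proj₁ z * f (proj₂ z)) zs
    ∑-negate f [] = sym -0#≈0#
    ∑-negate f (z ∷ zs) = trans (+-cong (sym (-‿distribˡ-* _ _)) (∑-negate f zs)) (-‿+-comm _ _)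

    evaluate-cong : ∀ xs ys → (∀ v → coeffOf xs v ≈ coeffOf ys v) → ∀ Φ → evaluate Φ xs ≈ evaluate Φ ys
    evaluate-cong xs ys coeffs≈ Φ = x∙y⁻¹≈ε⇒x≈y (evaluate Φ xs) (evaluate Φ ys) difference≈0
      where
      difference≈0 : evaluate Φ xs + - evaluate Φ ys ≈ 0#
      difference≈0 = trans (+-congˡ (sym (∑-negate Φ ys))) (trans (sym (∑-++ _ xs (negate ys)))
        (evaluate-zero _ (xs ++ negate ys) ℕP.≤-refl
          (λ v → trans (∑-++ _ xs (negate ys)) (trans (+-congˡ (∑-negate (λ u → 𝟙 (u == v)) ys))
                   (trans (+-congʳ (coeffs≈ v)) (-‿inverseʳ _))))
          Φ))

  -- Formal K-linear combinations of words of a monoid W, compared through their coefficients at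
  -- normal forms; `normalize` is a monoid morphism onto the normal forms.
  module MonoidAlgebra (W : Set) (_·_ : W → W → W) (ε : W) (normalize : W → W) (_==_ : W → W → Bool)
    (==-sound : ∀ {u v} → (u == v) ≡ true → u ≡ v) (==-refl : ∀ u → (u == u) ≡ true)
    (normalize-· : ∀ u v → normalize (u · v) ≡ normalize u · normalize v)
    (·-assoc : ∀ u v z → (u · v) · z ≡ u · (v · z))
    (·-identityˡ : ∀ u → ε · u ≡ u) (·-identityʳ : ∀ u → u · ε ≡ u) where

    Elt : Set c
    Elt = List (K × W)

    hits : W → W → K
    hits u w = 𝟙 (normalize u == w)

    coeffAt : Elt → W → K
    coeffAt x w = ∑ (λ s → proj₁ s * hits (proj₂ s) w) x

    infix 4 _≋_
    record _≋_ (x y : Elt) : Set ℓ where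
      constructor mk≋
      field at : ∀ w → coeffAt x w ≈ coeffAt y w
    open _≋_ public

    infixl 7 _⋆_
    _⋆_ : Elt → Elt → Elt
    x ⋆ y = concatMap (λ s → map (λ s' → (proj₁ s * proj₁ s' , proj₂ s · proj₂ s')) y) x

    infixr 8 _•_
    _•_ : K → Elt → Elt
    a • x = map (λ s → (a * proj₁ s , proj₂ s)) x

    𝟏 : Elt
    𝟏 = (1# , ε) ∷ []

    ∑ᴱ : List Elt → Elt
    ∑ᴱ = foldr _++_ []

    ≋-refl : ∀ {x} → x ≋ x
    ≋-refl = mk≋ λ w → refl

    ≋-sym : ∀ {x y} → x ≋ y → y ≋ x
    ≋-sym e = mk≋ λ w → sym (at e w)

    ≋-trans : ∀ {x y z} → x ≋ y → y ≋ z → x ≋ z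
    ≋-trans e f = mk≋ λ w → trans (at e w) (at f w)

    ≡⇒≋ : ∀ {x y} → x ≡ y → x ≋ y
    ≡⇒≋ P.refl = ≋-refl

    ≋-setoid : Setoid c ℓ
    ≋-setoid = record { Carrier = Elt ; _≈_ = _≋_ ; isEquivalence = record { refl = ≋-refl ; sym = ≋-sym ; trans = ≋-trans } }

    module ≋-Reasoning = Relation.Binary.Reasoning.Setoid ≋-setoid

    coeffAt-++ : ∀ x y w → coeffAt (x ++ y) w ≈ coeffAt x w + coeffAt y w
    coeffAt-++ x y w = ∑-++ _ x y

    ++-cong : ∀ {x x' y y'} → x ≋ x' → y ≋ y' → x ++ y ≋ x' ++ y'
    ++-cong {x} {x'} {y} {y'} e f =
      mk≋ λ w → trans (coeffAt-++ x y w) (trans (+-cong (at e w) (at f w)) (sym (coeffAt-++ x' y' w)))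

    ++-comm : ∀ x y → x ++ y ≋ y ++ x
    ++-comm x y = mk≋ λ w → trans (coeffAt-++ x y w) (trans (+-comm _ _) (sym (coeffAt-++ y x w)))

    ++-assoc : ∀ x y z → (x ++ y) ++ z ≋ x ++ (y ++ z)
    ++-assoc x y z = ≡⇒≋ (LP.++-assoc x y z)

    ++-identityʳ : ∀ x → x ++ [] ≋ x
    ++-identityʳ x = ≡⇒≋ (LP.++-identityʳ x)

    ++-interchange : ∀ x y x' y' → (x ++ y) ++ (x' ++ y') ≋ (x ++ x') ++ (y ++ y')
    ++-interchange x y x' y' = mk≋ λ w → begin
      coeffAt ((x ++ y) ++ (x' ++ y')) w
        ≈⟨ trans (coeffAt-++ (x ++ y) _ w) (+-cong (coeffAt-++ x y w) (coeffAt-++ x' y' w)) ⟩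
      (coeffAt x w + coeffAt y w) + (coeffAt x' w + coeffAt y' w)
        ≈⟨ solve 4 (λ a b c d → (a :+ b) :+ (c :+ d) := (a :+ c) :+ (b :+ d)) refl _ _ _ _ ⟩
      (coeffAt x w + coeffAt x' w) + (coeffAt y w + coeffAt y' w)
        ≈⟨ sym (trans (coeffAt-++ (x ++ x') _ w) (+-cong (coeffAt-++ x x' w) (coeffAt-++ y y' w))) ⟩
      coeffAt ((x ++ x') ++ (y ++ y')) w ∎
      where
        open ≈-Reasoning

    coeffAt-• : ∀ a x w → coeffAt (a • x) w ≈ a * coeffAt x w
    coeffAt-• a x w = trans (reflexive (∑-map _ _ x)) (trans (∑-cong (λ s → *-assoc _ _ _) x) (∑-*ˡ a _ x))

    •-cong : ∀ {a b x y} → a ≈ b → x ≋ y → a • x ≋ b • y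
    •-cong {a} {b} {x} {y} e f = mk≋ λ w → trans (coeffAt-• a x w) (trans (*-cong e (at f w)) (sym (coeffAt-• b y w)))

    •-congˡ : ∀ a {x y} → x ≋ y → a • x ≋ a • y
    •-congˡ a = •-cong refl

    •-++ : ∀ a x y → a • (x ++ y) ≋ a • x ++ a • y
    •-++ a x y = ≡⇒≋ (LP.map-++ _ x y)

    •-assoc : ∀ a b x → a • b • x ≋ (a * b) • x
    •-assoc a b x = mk≋ λ w → trans (coeffAt-• a (b • x) w)
      (trans (*-congˡ (coeffAt-• b x w)) (trans (sym (*-assoc _ _ _)) (sym (coeffAt-• (a * b) x w))))

    •-identity : ∀ x → 1# • x ≋ x
    •-identity x = mk≋ λ w → trans (coeffAt-• _ x w) (*-identityˡ _)

    •-zero : ∀ x → 0# • x ≋ []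
    •-zero x = mk≋ λ w → trans (coeffAt-• _ x w) (zeroˡ _)

    ++-•-regroup : ∀ a o x y → (o ++ a • y) ++ a • x ≋ o ++ a • (x ++ y)
    ++-•-regroup a o x y = mk≋ λ w → begin
      coeffAt ((o ++ a • y) ++ a • x) w
        ≈⟨ trans (coeffAt-++ (o ++ a • y) _ w) (+-cong (trans (coeffAt-++ o _ w) (+-congˡ (coeffAt-• a y w))) (coeffAt-• a x w)) ⟩
      (coeffAt o w + a * coeffAt y w) + a * coeffAt x w
        ≈⟨ solve 4 (λ o b a c → (o :+ a :* b) :+ a :* c := o :+ a :* (c :+ b)) refl _ _ a _ ⟩
      coeffAt o w + a * (coeffAt x w + coeffAt y w)
        ≈⟨ sym (trans (coeffAt-++ o _ w) (+-congˡ (trans (coeffAt-• a (x ++ y) w) (*-congˡ (coeffAt-++ x y w))))) ⟩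
      coeffAt (o ++ a • (x ++ y)) w ∎
      where
        open ≈-Reasoning

    ++-•-regroup₂ : ∀ a b o x y → (o ++ a • (x ++ y)) ++ b • x ≋ (o ++ (b + a) • x) ++ a • y
    ++-•-regroup₂ a b o x y = mk≋ λ w → begin
      coeffAt ((o ++ a • (x ++ y)) ++ b • x) w
        ≈⟨ trans (coeffAt-++ (o ++ a • (x ++ y)) _ w)
                 (+-cong (trans (coeffAt-++ o _ w) (+-congˡ (trans (coeffAt-• a (x ++ y) w) (*-congˡ (coeffAt-++ x y w))))) (coeffAt-• b x w)) ⟩
      (coeffAt o w + a * (coeffAt x w + coeffAt y w)) + b * coeffAt x w
        ≈⟨ solve 5 (λ o a x y b → (o :+ a :* (x :+ y)) :+ b :* x := (o :+ (b :+ a) :* x) :+ a :* y) refl _ a _ _ b ⟩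
      (coeffAt o w + (b + a) * coeffAt x w) + a * coeffAt y w
        ≈⟨ sym (trans (coeffAt-++ (o ++ (b + a) • x) _ w) (+-cong (trans (coeffAt-++ o _ w) (+-congˡ (coeffAt-• (b + a) x w))) (coeffAt-• a y w))) ⟩
      coeffAt ((o ++ (b + a) • x) ++ a • y) w ∎
      where
        open ≈-Reasoning

    open FormalSums _==_ ==-sound ==-refl using (coeffOf; evaluate; evaluate-cong)

    normalized : Elt → Elt
    normalized = map (λ s → (proj₁ s , normalize (proj₂ s)))

    linearAt : (W → K) → Elt → K
    linearAt Φ x = ∑ (λ s → proj₁ s * Φ (normalize (proj₂ s))) x

    linearAt-cong : ∀ Φ {x y} → x ≋ y → linearAt Φ x ≈ linearAt Φ y
    linearAt-cong Φ {x} {y} e =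
      trans (sym (reflexive (∑-map _ _ x))) (trans (evaluate-cong (normalized x) (normalized y) coeffs≈ Φ) (reflexive (∑-map _ _ y)))
      where
      coeffs≈ : ∀ v → coeffOf (normalized x) v ≈ coeffOf (normalized y) v
      coeffs≈ v = trans (reflexive (∑-map _ _ x)) (trans (at e v) (sym (reflexive (∑-map _ _ y))))

    ∑-⋆ : (g : K × W → K) → ∀ x y → ∑ g (x ⋆ y) ≈ ∑ (λ s → ∑ (λ s' → g (proj₁ s * proj₁ s' , proj₂ s · proj₂ s')) y) x
    ∑-⋆ g x y = trans (∑-concatMap g _ x) (∑-cong (λ s → reflexive (∑-map g _ y)) x)

    hits-· : ∀ u v w → hits (u · v) w ≡ 𝟙 ((normalize u · normalize v) == w)
    hits-· u v w = P.cong (λ z → 𝟙 (z == w)) (normalize-· u v)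

    -- Coefficients of a product are linear in each factor separately, which gives congruence.
    ⋆-cong : ∀ {x x' y y'} → x ≋ x' → y ≋ y' → x ⋆ y ≋ x' ⋆ y'
    ⋆-cong {x} {x'} {y} {y'} e f = mk≋ λ w → begin
      coeffAt (x ⋆ y) w     ≈⟨ linear-in-left x y w ⟩
      linearAt (left y w) x  ≈⟨ linearAt-cong (left y w) e ⟩
      linearAt (left y w) x' ≈⟨ sym (linear-in-left x' y w) ⟩
      coeffAt (x' ⋆ y) w    ≈⟨ linear-in-right x' y w ⟩
      linearAt (right x' w) y  ≈⟨ linearAt-cong (right x' w) f ⟩
      linearAt (right x' w) y' ≈⟨ sym (linear-in-right x' y' w) ⟩
      coeffAt (x' ⋆ y') w   ∎
      where
      open ≈-Reasoning
      left : Elt → W → W → K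
      left y w ω = ∑ (λ s → proj₁ s * 𝟙 ((ω · normalize (proj₂ s)) == w)) y
      right : Elt → W → W → K
      right x w ω = ∑ (λ s → proj₁ s * 𝟙 ((normalize (proj₂ s) · ω) == w)) x
      linear-in-left : ∀ x y w → coeffAt (x ⋆ y) w ≈ linearAt (left y w) x
      linear-in-left x y w = trans (∑-⋆ _ x y) (∑-cong (λ s → trans (∑-cong (λ s' →
        trans (*-assoc _ _ _) (*-congˡ (*-congˡ (reflexive (hits-· (proj₂ s) (proj₂ s') w))))) y) (∑-*ˡ (proj₁ s) _ y)) x)
      linear-in-right : ∀ x y w → coeffAt (x ⋆ y) w ≈ linearAt (right x w) y
      linear-in-right x y w = trans (∑-⋆ _ x y) (trans (∑-comm _ x y) (∑-cong (λ s' → trans (∑-cong (λ s →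
        trans (*-congʳ (*-comm _ _)) (trans (*-assoc _ _ _) (*-congˡ (*-congˡ (reflexive (hits-· (proj₂ s) (proj₂ s') w)))))) x)
        (∑-*ˡ (proj₁ s') _ x)) y))

    ⋆-assoc : ∀ x y z → (x ⋆ y) ⋆ z ≋ x ⋆ (y ⋆ z)
    ⋆-assoc x y z = mk≋ λ w → begin
      coeffAt ((x ⋆ y) ⋆ z) w
        ≈⟨ trans (∑-⋆ _ (x ⋆ y) z) (∑-⋆ _ x y) ⟩
      ∑ (λ s → ∑ (λ s' → ∑ (λ s'' → ((proj₁ s * proj₁ s') * proj₁ s'') * hits ((proj₂ s · proj₂ s') · proj₂ s'') w) z) y) x
        ≈⟨ ∑-cong (λ s → ∑-cong (λ s' → ∑-cong (λ s'' →
             *-cong (*-assoc _ _ _) (reflexive (P.cong (λ v → hits v w) (·-assoc _ _ _)))) z) y) x ⟩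
      ∑ (λ s → ∑ (λ s' → ∑ (λ s'' → (proj₁ s * (proj₁ s' * proj₁ s'')) * hits (proj₂ s · (proj₂ s' · proj₂ s'')) w) z) y) x
        ≈⟨ ∑-cong (λ s → sym (∑-⋆ (λ u → (proj₁ s * proj₁ u) * hits (proj₂ s · proj₂ u) w) y z)) x ⟩
      ∑ (λ s → ∑ (λ u → (proj₁ s * proj₁ u) * hits (proj₂ s · proj₂ u) w) (y ⋆ z)) x
        ≈⟨ sym (∑-⋆ _ x (y ⋆ z)) ⟩
      coeffAt (x ⋆ (y ⋆ z)) w ∎
      where
        open ≈-Reasoning

    ⋆-distribʳ : ∀ x y z → (x ++ y) ⋆ z ≋ x ⋆ z ++ y ⋆ z
    ⋆-distribʳ x y z = ≡⇒≋ (LP.concatMap-++ _ x y)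

    ⋆-distribˡ : ∀ x y z → x ⋆ (y ++ z) ≋ x ⋆ y ++ x ⋆ z
    ⋆-distribˡ x y z = mk≋ λ w → begin
      coeffAt (x ⋆ (y ++ z)) w                ≈⟨ ∑-⋆ _ x (y ++ z) ⟩
      ∑ (λ s → ∑ _ (y ++ z)) x               ≈⟨ ∑-cong (λ s → ∑-++ _ y z) x ⟩
      ∑ (λ s → ∑ _ y + ∑ _ z) x              ≈⟨ ∑-+ _ _ x ⟩
      ∑ (λ s → ∑ _ y) x + ∑ (λ s → ∑ _ z) x ≈⟨ +-cong (sym (∑-⋆ _ x y)) (sym (∑-⋆ _ x z)) ⟩
      coeffAt (x ⋆ y) w + coeffAt (x ⋆ z) w   ≈⟨ sym (coeffAt-++ (x ⋆ y) (x ⋆ z) w) ⟩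
      coeffAt (x ⋆ y ++ x ⋆ z) w              ∎
      where
        open ≈-Reasoning

    ⋆-identityˡ : ∀ y → 𝟏 ⋆ y ≋ y
    ⋆-identityˡ y = mk≋ λ w → trans (∑-⋆ _ 𝟏 y) (trans (+-identityʳ _)
      (∑-cong (λ s → *-cong (*-identityˡ _) (reflexive (P.cong (λ v → hits v w) (·-identityˡ _)))) y))

    ⋆-identityʳ : ∀ x → x ⋆ 𝟏 ≋ x
    ⋆-identityʳ x = mk≋ λ w → trans (∑-⋆ _ x 𝟏)
      (∑-cong (λ s → trans (+-identityʳ _) (*-cong (*-identityʳ _) (reflexive (P.cong (λ v → hits v w) (·-identityʳ _))))) x)

    ⋆-zeroʳ : ∀ x → x ⋆ [] ≋ []
    ⋆-zeroʳ x = mk≋ λ w → trans (∑-⋆ _ x []) (∑-zero (λ _ → refl) x)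

    ⋆-•ˡ : ∀ a x y → (a • x) ⋆ y ≋ a • (x ⋆ y)
    ⋆-•ˡ a x y = mk≋ λ w → begin
      coeffAt ((a • x) ⋆ y) w
        ≈⟨ trans (∑-⋆ _ (a • x) y) (reflexive (∑-map _ _ x)) ⟩
      ∑ (λ s → ∑ (λ s' → ((a * proj₁ s) * proj₁ s') * hits (proj₂ s · proj₂ s') w) y) x
        ≈⟨ ∑-cong (λ s → trans (∑-cong (λ s' → trans (*-congʳ (*-assoc _ _ _)) (*-assoc _ _ _)) y) (∑-*ˡ a _ y)) x ⟩
      ∑ (λ s → a * ∑ (λ s' → (proj₁ s * proj₁ s') * hits (proj₂ s · proj₂ s') w) y) x
        ≈⟨ trans (∑-*ˡ a _ x) (*-congˡ (sym (∑-⋆ _ x y))) ⟩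
      a * coeffAt (x ⋆ y) w
        ≈⟨ sym (coeffAt-• a (x ⋆ y) w) ⟩
      coeffAt (a • (x ⋆ y)) w ∎
      where
        open ≈-Reasoning

    ⋆-•ʳ : ∀ a x y → x ⋆ (a • y) ≋ a • (x ⋆ y)
    ⋆-•ʳ a x y = mk≋ λ w → begin
      coeffAt (x ⋆ (a • y)) w
        ≈⟨ trans (∑-⋆ _ x (a • y)) (∑-cong (λ s → reflexive (∑-map _ _ y)) x) ⟩
      ∑ (λ s → ∑ (λ s' → (proj₁ s * (a * proj₁ s')) * hits (proj₂ s · proj₂ s') w) y) x
        ≈⟨ ∑-cong (λ s → trans (∑-cong (λ s' → *-congʳ (solve 3 (λ b a b' → b :* (a :* b') := a :* (b :* b')) refl _ a _)) y)
             (trans (∑-cong (λ s' → *-assoc _ _ _) y) (∑-*ˡ a _ y))) x ⟩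
      ∑ (λ s → a * ∑ (λ s' → (proj₁ s * proj₁ s') * hits (proj₂ s · proj₂ s') w) y) x
        ≈⟨ trans (∑-*ˡ a _ x) (*-congˡ (sym (∑-⋆ _ x y))) ⟩
      a * coeffAt (x ⋆ y) w
        ≈⟨ sym (coeffAt-• a (x ⋆ y) w) ⟩
      coeffAt (a • (x ⋆ y)) w ∎
      where
        open ≈-Reasoning

    coeffAt-∑ᴱ : ∀ xs w → coeffAt (∑ᴱ xs) w ≈ ∑ (λ x → coeffAt x w) xs
    coeffAt-∑ᴱ [] w = refl
    coeffAt-∑ᴱ (x ∷ xs) w = trans (coeffAt-++ x (∑ᴱ xs) w) (+-congˡ (coeffAt-∑ᴱ xs w))

    coeffAt-∑ᴱ-map : ∀ {a} {A : Set a} (f : A → Elt) xs w → coeffAt (∑ᴱ (map f xs)) w ≈ ∑ (λ x → coeffAt (f x) w) xs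
    coeffAt-∑ᴱ-map f xs w = trans (coeffAt-∑ᴱ (map f xs) w) (reflexive (∑-map (λ x → coeffAt x w) f xs))

    ∑ᴱ-cong : ∀ {a} {A : Set a} {f g : A → Elt} → (∀ i → f i ≋ g i) → ∀ xs → ∑ᴱ (map f xs) ≋ ∑ᴱ (map g xs)
    ∑ᴱ-cong e [] = ≋-refl
    ∑ᴱ-cong e (i ∷ xs) = ++-cong (e i) (∑ᴱ-cong e xs)

    ∑ᴱ-++ : ∀ xs ys → ∑ᴱ (xs ++ ys) ≋ ∑ᴱ xs ++ ∑ᴱ ys
    ∑ᴱ-++ [] ys = ≋-refl
    ∑ᴱ-++ (x ∷ xs) ys = ≋-trans (++-cong (≋-refl {x}) (∑ᴱ-++ xs ys)) (≋-sym (++-assoc x (∑ᴱ xs) (∑ᴱ ys)))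

    ∑ᴱ-map-++ : ∀ {a} {A : Set a} (f g : A → Elt) xs → ∑ᴱ (map (λ x → f x ++ g x) xs) ≋ ∑ᴱ (map f xs) ++ ∑ᴱ (map g xs)
    ∑ᴱ-map-++ f g xs = mk≋ λ w → trans (coeffAt-∑ᴱ-map (λ x → f x ++ g x) xs w) (trans (∑-cong (λ x → coeffAt-++ (f x) (g x) w) xs)
      (trans (∑-+ _ _ xs) (sym (trans (coeffAt-++ (∑ᴱ (map f xs)) _ w) (+-cong (coeffAt-∑ᴱ-map f xs w) (coeffAt-∑ᴱ-map g xs w))))))

    ∑ᴱ-⋆ : ∀ xs y → ∑ᴱ xs ⋆ y ≋ ∑ᴱ (map (_⋆ y) xs)
    ∑ᴱ-⋆ [] y = ≋-refl
    ∑ᴱ-⋆ (x ∷ xs) y = ≋-trans (⋆-distribʳ x (∑ᴱ xs) y) (++-cong ≋-refl (∑ᴱ-⋆ xs y))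

    ⋆-∑ᴱ : ∀ x ys → x ⋆ ∑ᴱ ys ≋ ∑ᴱ (map (x ⋆_) ys)
    ⋆-∑ᴱ x [] = ⋆-zeroʳ x
    ⋆-∑ᴱ x (y ∷ ys) = ≋-trans (⋆-distribˡ x y (∑ᴱ ys)) (++-cong ≋-refl (⋆-∑ᴱ x ys))

    •-∑ᴱ : ∀ a xs → a • ∑ᴱ xs ≋ ∑ᴱ (map (a •_) xs)
    •-∑ᴱ a [] = ≋-refl
    •-∑ᴱ a (x ∷ xs) = ≋-trans (•-++ a x (∑ᴱ xs)) (++-cong ≋-refl (•-∑ᴱ a xs))

    Seq : Set c
    Seq = ℕ → Elt

    infix 4 _≋ˢ_
    _≋ˢ_ : Seq → Seq → Set ℓ
    U ≋ˢ V = ∀ n → U n ≋ V n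

    shift : Seq → Seq
    shift U n = U (suc n)

    conv : Seq → Seq → Seq
    conv U V zero = U 0 ⋆ V 0
    conv U V (suc k) = U 0 ⋆ V (suc k) ++ conv (shift U) V k

    𝟏ˢ : Seq
    𝟏ˢ zero = 𝟏
    𝟏ˢ (suc n) = []

    infixl 6 _⊕_
    _⊕_ : Seq → Seq → Seq
    (U ⊕ V) n = U n ++ V n

    infixr 8 _•ˢ_
    _•ˢ_ : K → Seq → Seq
    (a •ˢ U) n = a • U n

    ≋ˢ-refl : ∀ {U} → U ≋ˢ U
    ≋ˢ-refl n = ≋-refl

    ≋ˢ-sym : ∀ {U V} → U ≋ˢ V → V ≋ˢ U
    ≋ˢ-sym e n = ≋-sym (e n)

    conv-cong : ∀ {U U' V V'} → U ≋ˢ U' → V ≋ˢ V' → conv U V ≋ˢ conv U' V'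
    conv-cong e f zero = ⋆-cong (e 0) (f 0)
    conv-cong e f (suc k) = ++-cong (⋆-cong (e 0) (f (suc k))) (conv-cong (e ∘ suc) f k)

    conv-congˡ : ∀ {U U'} V → U ≋ˢ U' → conv U V ≋ˢ conv U' V
    conv-congˡ V e = conv-cong e ≋ˢ-refl

    conv-congʳ : ∀ U {V V'} → V ≋ˢ V' → conv U V ≋ˢ conv U V'
    conv-congʳ U = conv-cong ≋ˢ-refl

    conv-congʳ-upTo : ∀ U {V V'} k → (∀ j → j ≤ k → V j ≋ V' j) → conv U V k ≋ conv U V' k
    conv-congʳ-upTo U zero h = ⋆-cong (≋-refl {U 0}) (h 0 z≤n)
    conv-congʳ-upTo U (suc k) h =
      ++-cong (⋆-cong (≋-refl {U 0}) (h (suc k) ℕP.≤-refl)) (conv-congʳ-upTo (shift U) k (λ j j≤k → h j (ℕP.m≤n⇒m≤1+n j≤k)))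

    conv-⊕ˡ : ∀ U U' V → conv (U ⊕ U') V ≋ˢ conv U V ⊕ conv U' V
    conv-⊕ˡ U U' V zero = ⋆-distribʳ (U 0) (U' 0) (V 0)
    conv-⊕ˡ U U' V (suc k) =
      ≋-trans (++-cong (⋆-distribʳ (U 0) (U' 0) (V (suc k))) (conv-⊕ˡ (shift U) (shift U') V k))
              (++-interchange (U 0 ⋆ V (suc k)) (U' 0 ⋆ V (suc k)) (conv (shift U) V k) (conv (shift U') V k))

    conv-⊕ʳ : ∀ U V V' → conv U (V ⊕ V') ≋ˢ conv U V ⊕ conv U V'
    conv-⊕ʳ U V V' zero = ⋆-distribˡ (U 0) (V 0) (V' 0)
    conv-⊕ʳ U V V' (suc k) =
      ≋-trans (++-cong (⋆-distribˡ (U 0) (V (suc k)) (V' (suc k))) (conv-⊕ʳ (shift U) V V' k))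
              (++-interchange (U 0 ⋆ V (suc k)) (U 0 ⋆ V' (suc k)) (conv (shift U) V k) (conv (shift U) V' k))

    conv-•ˡ : ∀ a U V → conv (a •ˢ U) V ≋ˢ a •ˢ conv U V
    conv-•ˡ a U V zero = ⋆-•ˡ a (U 0) (V 0)
    conv-•ˡ a U V (suc k) =
      ≋-trans (++-cong (⋆-•ˡ a (U 0) (V (suc k))) (conv-•ˡ a (shift U) V k)) (≋-sym (•-++ a (U 0 ⋆ V (suc k)) (conv (shift U) V k)))

    conv-•ʳ : ∀ a U V → conv U (a •ˢ V) ≋ˢ a •ˢ conv U V
    conv-•ʳ a U V zero = ⋆-•ʳ a (U 0) (V 0)
    conv-•ʳ a U V (suc k) =
      ≋-trans (++-cong (⋆-•ʳ a (U 0) (V (suc k))) (conv-•ʳ a (shift U) V k)) (≋-sym (•-++ a (U 0 ⋆ V (suc k)) (conv (shift U) V k)))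

    conv-⋆ˡ : ∀ x U V → conv (λ n → x ⋆ U n) V ≋ˢ (λ n → x ⋆ conv U V n)
    conv-⋆ˡ x U V zero = ⋆-assoc x (U 0) (V 0)
    conv-⋆ˡ x U V (suc k) = ≋-trans (++-cong (⋆-assoc x (U 0) (V (suc k))) (conv-⋆ˡ x (shift U) V k)) (≋-sym (⋆-distribˡ x _ _))

    conv-assoc : ∀ U V X → conv (conv U V) X ≋ˢ conv U (conv V X)
    conv-assoc U V X zero = ⋆-assoc (U 0) (V 0) (X 0)
    conv-assoc U V X (suc k) =
      ≋-trans (++-cong (≋-refl {A}) (conv-⊕ˡ (λ n → U 0 ⋆ V (suc n)) (conv (shift U) V) X k))
      (≋-trans (++-cong (≋-refl {A}) (++-cong (conv-⋆ˡ (U 0) (shift V) X k) (conv-assoc (shift U) V X k)))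
      (≋-trans (≋-sym (++-assoc A _ _))
      (++-cong (≋-trans (++-cong (⋆-assoc (U 0) (V 0) (X (suc k))) ≋-refl) (≋-sym (⋆-distribˡ (U 0) _ _))) ≋-refl)))
      where
      A = (U 0 ⋆ V 0) ⋆ X (suc k)

    conv-𝟏ʳ : ∀ U → conv U 𝟏ˢ ≋ˢ U
    conv-𝟏ʳ U zero = ⋆-identityʳ (U 0)
    conv-𝟏ʳ U (suc k) = ≋-trans (++-cong (⋆-zeroʳ (U 0)) ≋-refl) (conv-𝟏ʳ (shift U) k)

    conv-zeroˡ : ∀ V → conv (λ _ → []) V ≋ˢ (λ _ → [])
    conv-zeroˡ V zero = ≋-refl
    conv-zeroˡ V (suc k) = conv-zeroˡ V k

    conv-𝟏ˡ : ∀ V → conv 𝟏ˢ V ≋ˢ V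
    conv-𝟏ˡ V zero = ⋆-identityˡ (V 0)
    conv-𝟏ˡ V (suc k) = ≋-trans (++-cong (⋆-identityˡ (V (suc k))) (conv-zeroˡ V k)) (++-identityʳ (V (suc k)))

    conv≋∑ᴱ : ∀ U V k → conv U V k ≋ ∑ᴱ (map (λ i → U i ⋆ V (k ∸ i)) (upTo (suc k)))
    conv≋∑ᴱ U V zero = ≋-sym (++-identityʳ _)
    conv≋∑ᴱ U V (suc k) = ++-cong ≋-refl (≋-trans (conv≋∑ᴱ (shift U) V k)
      (≡⇒≋ (P.cong ∑ᴱ (P.trans (LP.map-upTo _ (suc k)) (P.sym (LP.map-applyUpTo suc (λ i → U i ⋆ V (suc k ∸ i)) (suc k)))))))

    ∑ᴱ-upTo-reverse : ∀ (g : ℕ → ℕ → Elt) k →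
      ∑ᴱ (map (λ i → g i (k ∸ i)) (upTo (suc k))) ≋ ∑ᴱ (map (λ i → g (k ∸ i) i) (upTo (suc k)))
    ∑ᴱ-upTo-reverse g k = mk≋ λ w → begin
      coeffAt (∑ᴱ (map (λ i → g i (k ∸ i)) (upTo (suc k)))) w ≈⟨ coeffAt-∑ᴱ-map (λ i → g i (k ∸ i)) (upTo (suc k)) w ⟩
      ∑ (λ i → coeffAt (g i (k ∸ i)) w) (upTo (suc k))         ≈⟨ ∑-upTo-reverse (λ i → coeffAt (g i (k ∸ i)) w) k ⟩
      ∑ (λ i → coeffAt (g (k ∸ i) (k ∸ (k ∸ i))) w) (upTo (suc k))
        ≈⟨ ∑-cong-All (applyUpTo⁺₁ id (suc k) (λ {i} i<1+k →
             reflexive (P.cong (λ j → coeffAt (g (k ∸ i) j) w) (ℕP.m∸[m∸n]≡n (ℕP.≤-pred i<1+k))))) ⟩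
      ∑ (λ i → coeffAt (g (k ∸ i) i) w) (upTo (suc k))         ≈⟨ sym (coeffAt-∑ᴱ-map (λ i → g (k ∸ i) i) (upTo (suc k)) w) ⟩
      coeffAt (∑ᴱ (map (λ i → g (k ∸ i) i) (upTo (suc k)))) w ∎
      where
        open ≈-Reasoning

    conv-comm : ∀ U V → (∀ i j → U i ⋆ V j ≋ V j ⋆ U i) → conv U V ≋ˢ conv V U
    conv-comm U V commute k =
      ≋-trans (conv≋∑ᴱ U V k) (≋-trans (∑ᴱ-upTo-reverse (λ i j → U i ⋆ V j) k)
        (≋-trans (∑ᴱ-cong (λ i → commute (k ∸ i) i) (upTo (suc k))) (≋-sym (conv≋∑ᴱ V U k))))

  _==ᶜ_ : Comp → Comp → Bool
  u ==ᶜ v = ⌊ u ≟C v ⌋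

  ==ᶜ-sound : ∀ {u v} → (u ==ᶜ v) ≡ true → u ≡ v
  ==ᶜ-sound {u} {v} e with u ≟C v
  ... | yes u≡v = u≡v

  ==ᶜ-refl : ∀ u → (u ==ᶜ u) ≡ true
  ==ᶜ-refl u with u ≟C u
  ... | yes _ = P.refl
  ... | no u≢u = ⊥-elim (u≢u P.refl)

  norm-++ : ∀ u v → norm (u ++ v) ≡ norm u ++ norm v
  norm-++ u v = LP.filter-++ _ u v

  module Nsym = MonoidAlgebra Comp _++_ [] norm _==ᶜ_ ==ᶜ-sound ==ᶜ-refl norm-++ LP.++-assoc (λ _ → P.refl) LP.++-identityʳ

  Comp² : Set
  Comp² = Comp × Comp

  _·²_ : Comp² → Comp² → Comp²
  (α , β) ·² (γ , δ) = (α ++ γ , β ++ δ)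

  norm² : Comp² → Comp²
  norm² (α , β) = (norm α , norm β)

  _==²_ : Comp² → Comp² → Bool
  (α , β) ==² (γ , δ) = (α ==ᶜ γ) ∧ (β ==ᶜ δ)

  ==²-sound : ∀ {u v} → (u ==² v) ≡ true → u ≡ v
  ==²-sound {α , β} {γ , δ} e with α ==ᶜ γ in α==γ | β ==ᶜ δ in β==δ
  ... | true | true = P.cong₂ _,_ (==ᶜ-sound α==γ) (==ᶜ-sound β==δ)

  ==²-refl : ∀ u → (u ==² u) ≡ true
  ==²-refl (α , β) rewrite ==ᶜ-refl α | ==ᶜ-refl β = P.refl

  norm²-·² : ∀ u v → norm² (u ·² v) ≡ norm² u ·² norm² v
  norm²-·² (α , β) (γ , δ) = P.cong₂ _,_ (norm-++ α γ) (norm-++ β δ)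

  ·²-assoc : ∀ u v w → (u ·² v) ·² w ≡ u ·² (v ·² w)
  ·²-assoc (α , β) (γ , δ) (ε , ζ) = P.cong₂ _,_ (LP.++-assoc α γ ε) (LP.++-assoc β δ ζ)

  ·²-identityʳ : ∀ u → u ·² ([] , []) ≡ u
  ·²-identityʳ (α , β) = P.cong₂ _,_ (LP.++-identityʳ α) (LP.++-identityʳ β)

  module Tensor = MonoidAlgebra Comp² _·²_ ([] , []) norm² _==²_ ==²-sound ==²-refl norm²-·² ·²-assoc (λ _ → P.refl) ·²-identityʳ

  infix 4 _≈ₙ_ _≈ₜ_
  _≈ₙ_ : NSym → NSym → Set ℓ
  _≈ₙ_ = Nsym._≋_

  _≈ₜ_ : T → T → Set ℓ
  _≈ₜ_ = Tensor._≋_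

  coeff≈coeffAt : ∀ x γ → coeff x γ ≈ Nsym.coeffAt x γ
  coeff≈coeffAt [] γ = refl
  coeff≈coeffAt ((a , α) ∷ xs) γ = +-cong (if-then-0≈*𝟙 (norm α ==ᶜ γ) a) (coeff≈coeffAt xs γ)

  coeffT≈coeffAt : ∀ x γ δ → coeffT x γ δ ≈ Tensor.coeffAt x (γ , δ)
  coeffT≈coeffAt [] γ δ = refl
  coeffT≈coeffAt ((a , α , β) ∷ xs) γ δ = +-cong (if-then-0≈*𝟙 ((norm α ==ᶜ γ) ∧ (norm β ==ᶜ δ)) a) (coeffT≈coeffAt xs γ δ)

  ≈ₙ⇒≈N : ∀ {x y} → x ≈ₙ y → x ≈N y
  ≈ₙ⇒≈N {x} {y} e γ = trans (coeff≈coeffAt x γ) (trans (Nsym.at e γ) (sym (coeff≈coeffAt y γ)))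

  ≈N⇒≈ₙ : ∀ {x y} → x ≈N y → x ≈ₙ y
  ≈N⇒≈ₙ {x} {y} e = Nsym.mk≋ λ γ → trans (sym (coeff≈coeffAt x γ)) (trans (e γ) (coeff≈coeffAt y γ))

  ≈ₜ⇒≈T : ∀ {x y} → x ≈ₜ y → x ≈T y
  ≈ₜ⇒≈T {x} {y} e γ δ = trans (coeffT≈coeffAt x γ δ) (trans (Tensor.at e (γ , δ)) (sym (coeffT≈coeffAt y γ δ)))

  ∑-⊗ : (g : K × Comp² → K) → ∀ x y → ∑ g (x ⊗ y) ≈ ∑ (λ s → ∑ (λ s' → g (proj₁ s * proj₁ s' , (proj₂ s , proj₂ s'))) y) x
  ∑-⊗ g x y = trans (∑-concatMap g _ x) (∑-cong (λ s → reflexive (∑-map g _ y)) x)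

  coeffAt-⊗ : ∀ x y γ δ → Tensor.coeffAt (x ⊗ y) (γ , δ) ≈ Nsym.coeffAt x γ * Nsym.coeffAt y δ
  coeffAt-⊗ x y γ δ = trans (∑-⊗ _ x y)
    (trans (∑-cong (λ s → ∑-cong (λ s' → split (proj₁ s) (proj₁ s') (norm (proj₂ s) ==ᶜ γ) (norm (proj₂ s') ==ᶜ δ)) y) x)
           (sym (∑-*-∑ _ _ x y)))
    where
    split : ∀ a b e e' → (a * b) * 𝟙 (e ∧ e') ≈ (a * 𝟙 e) * (b * 𝟙 e')
    split a b e e' = trans (*-congˡ (𝟙-∧ e e')) (solve 4 (λ a b i j → (a :* b) :* (i :* j) := (a :* i) :* (b :* j)) refl a b (𝟙 e) (𝟙 e'))

  ⊗-cong : ∀ {x x' y y'} → x ≈ₙ x' → y ≈ₙ y' → x ⊗ y ≈ₜ x' ⊗ y'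
  ⊗-cong {x} {x'} {y} {y'} e f = Tensor.mk≋ λ { (γ , δ) →
    trans (coeffAt-⊗ x y γ δ) (trans (*-cong (Nsym.at e γ) (Nsym.at f δ)) (sym (coeffAt-⊗ x' y' γ δ))) }

  ⊗-++ˡ : ∀ x x' y → (x ++ x') ⊗ y ≈ₜ x ⊗ y ++ x' ⊗ y
  ⊗-++ˡ x x' y = Tensor.≡⇒≋ (LP.concatMap-++ _ x x')

  ⊗-++ʳ : ∀ x y y' → x ⊗ (y ++ y') ≈ₜ x ⊗ y ++ x ⊗ y'
  ⊗-++ʳ x y y' = Tensor.mk≋ λ { (γ , δ) → trans (coeffAt-⊗ x (y ++ y') γ δ) (trans (*-congˡ (Nsym.coeffAt-++ y y' δ))
    (trans (distribˡ _ _ _) (sym (trans (Tensor.coeffAt-++ (x ⊗ y) (x ⊗ y') (γ , δ)) (+-cong (coeffAt-⊗ x y γ δ) (coeffAt-⊗ x y' γ δ)))))) }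

  ⊗-•ˡ : ∀ a x y → (a ·N x) ⊗ y ≈ₜ a ·T (x ⊗ y)
  ⊗-•ˡ a x y = Tensor.mk≋ λ { (γ , δ) → trans (coeffAt-⊗ (a ·N x) y γ δ) (trans (*-congʳ (Nsym.coeffAt-• a x γ))
    (trans (*-assoc _ _ _) (sym (trans (Tensor.coeffAt-• a (x ⊗ y) (γ , δ)) (*-congˡ (coeffAt-⊗ x y γ δ)))))) }

  ⊗-•ʳ : ∀ a x y → x ⊗ (a ·N y) ≈ₜ a ·T (x ⊗ y)
  ⊗-•ʳ a x y = Tensor.mk≋ λ { (γ , δ) → trans (coeffAt-⊗ x (a ·N y) γ δ) (trans (*-congˡ (Nsym.coeffAt-• a y δ))
    (trans (solve 3 (λ p a q → p :* (a :* q) := a :* (p :* q)) refl _ a _)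
           (sym (trans (Tensor.coeffAt-• a (x ⊗ y) (γ , δ)) (*-congˡ (coeffAt-⊗ x y γ δ)))))) }

  ⊗-⋆ : ∀ x y x' y' → (x ⊗ y) *T (x' ⊗ y') ≈ₜ (x *N x') ⊗ (y *N y')
  ⊗-⋆ x y x' y' = Tensor.mk≋ λ { (γ , δ) → begin
    Tensor.coeffAt ((x ⊗ y) *T (x' ⊗ y')) (γ , δ)
      ≈⟨ trans (Tensor.∑-⋆ _ (x ⊗ y) (x' ⊗ y')) (trans (∑-⊗ _ x y) (∑-cong (λ s → ∑-cong (λ s' → ∑-⊗ _ x' y') y) x)) ⟩
    ∑ (λ s → ∑ (λ s' → ∑ (λ r → ∑ (λ r' → term γ δ s s' r r') y') x') y) x
      ≈⟨ ∑-cong (λ s → ∑-comm _ y x') x ⟩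
    ∑ (λ s → ∑ (λ r → ∑ (λ s' → ∑ (λ r' → term γ δ s s' r r') y') y) x') x
      ≈⟨ ∑-cong (λ s → ∑-cong (λ r → ∑-cong (λ s' → ∑-cong (λ r' → factor γ δ s s' r r') y') y) x') x ⟩
    ∑ (λ s → ∑ (λ r → ∑ (λ s' → ∑ (λ r' → left γ s r * right δ s' r') y') y) x') x
      ≈⟨ ∑-cong (λ s → ∑-cong (λ r → trans (∑-cong (λ s' → ∑-*ˡ (left γ s r) (right δ s') y') y) (∑-*ˡ (left γ s r) _ y)) x') x ⟩
    ∑ (λ s → ∑ (λ r → left γ s r * ∑ (λ s' → ∑ (right δ s') y') y) x') x
      ≈⟨ trans (∑-cong (λ s → ∑-*ʳ _ (left γ s) x') x) (∑-*ʳ _ _ x) ⟩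
    ∑ (λ s → ∑ (left γ s) x') x * ∑ (λ s' → ∑ (right δ s') y') y
      ≈⟨ *-cong (sym (Nsym.∑-⋆ _ x x')) (sym (Nsym.∑-⋆ _ y y')) ⟩
    Nsym.coeffAt (x *N x') γ * Nsym.coeffAt (y *N y') δ
      ≈⟨ sym (coeffAt-⊗ (x *N x') (y *N y') γ δ) ⟩
    Tensor.coeffAt ((x *N x') ⊗ (y *N y')) (γ , δ) ∎ }
    where
    open ≈-Reasoning
    term : Comp → Comp → (s s' r r' : K × Comp) → K
    term γ δ s s' r r' = ((proj₁ s * proj₁ s') * (proj₁ r * proj₁ r')) * Tensor.hits (proj₂ s ++ proj₂ r , proj₂ s' ++ proj₂ r') (γ , δ)
    left : Comp → (s r : K × Comp) → K
    left γ s r = (proj₁ s * proj₁ r) * Nsym.hits (proj₂ s ++ proj₂ r) γ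
    right : Comp → (s' r' : K × Comp) → K
    right δ s' r' = (proj₁ s' * proj₁ r') * Nsym.hits (proj₂ s' ++ proj₂ r') δ
    factor : ∀ γ δ s s' r r' → term γ δ s s' r r' ≈ left γ s r * right δ s' r'
    factor γ δ s s' r r' = trans (*-congˡ (𝟙-∧ (norm (proj₂ s ++ proj₂ r) ==ᶜ γ) (norm (proj₂ s' ++ proj₂ r') ==ᶜ δ)))
      (solve 6 (λ a b a' b' i j → ((a :* b) :* (a' :* b')) :* (i :* j) := ((a :* a') :* i) :* ((b :* b') :* j)) refl _ _ _ _ _ _)

  1⊗1≈1 : 1N ⊗ 1N ≈ₜ 1T
  1⊗1≈1 = Tensor.mk≋ λ { (γ , δ) → +-congʳ (*-congʳ (*-identityʳ _)) }

  coeffAt-△ : ∀ x w → Tensor.coeffAt (△ x) w ≈ ∑ (λ s → proj₁ s * Tensor.coeffAt (△H (proj₂ s)) w) x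
  coeffAt-△ x w = trans (Tensor.coeffAt-∑ᴱ-map (λ s → proj₁ s ·T △H (proj₂ s)) x w)
                        (∑-cong (λ s → Tensor.coeffAt-• (proj₁ s) (△H (proj₂ s)) w) x)

  H0≈1 : Hk 0 ≈ₙ 1N
  H0≈1 = Nsym.mk≋ λ γ → refl

  △Hk0≈1 : △Hk 0 ≈ₜ 1T
  △Hk0≈1 = Tensor.≋-trans (Tensor.++-identityʳ _) (Tensor.≋-trans (⊗-cong H0≈1 H0≈1) 1⊗1≈1)

  △H-norm : ∀ α → △H (norm α) ≈ₜ △H α
  △H-norm [] = Tensor.≋-refl
  △H-norm (zero ∷ α) =
    Tensor.≋-trans (△H-norm α) (Tensor.≋-sym (Tensor.≋-trans (Tensor.⋆-cong △Hk0≈1 (Tensor.≋-refl {△H α})) (Tensor.⋆-identityˡ (△H α))))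
  △H-norm (suc n ∷ α) = Tensor.⋆-cong (Tensor.≋-refl {△Hk (suc n)}) (△H-norm α)

  △-cong : ∀ {x y} → x ≈ₙ y → △ x ≈ₜ △ y
  △-cong {x} {y} e = Tensor.mk≋ λ w → begin
    Tensor.coeffAt (△ x) w                              ≈⟨ coeffAt-△ x w ⟩
    ∑ (λ s → proj₁ s * Tensor.coeffAt (△H (proj₂ s)) w) x ≈⟨ ∑-cong (λ s → *-congˡ (sym (Tensor.at (△H-norm (proj₂ s)) w))) x ⟩
    Nsym.linearAt (λ ω → Tensor.coeffAt (△H ω) w) x      ≈⟨ Nsym.linearAt-cong (λ ω → Tensor.coeffAt (△H ω) w) e ⟩
    Nsym.linearAt (λ ω → Tensor.coeffAt (△H ω) w) y      ≈⟨ ∑-cong (λ s → *-congˡ (Tensor.at (△H-norm (proj₂ s)) w)) y ⟩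
    ∑ (λ s → proj₁ s * Tensor.coeffAt (△H (proj₂ s)) w) y ≈⟨ sym (coeffAt-△ y w) ⟩
    Tensor.coeffAt (△ y) w                              ∎
    where
      open ≈-Reasoning

  △H-++ : ∀ α β → △H (α ++ β) ≈ₜ △H α *T △H β
  △H-++ [] β = Tensor.≋-sym (Tensor.⋆-identityˡ (△H β))
  △H-++ (a ∷ α) β =
    Tensor.≋-trans (Tensor.⋆-cong (Tensor.≋-refl {△Hk a}) (△H-++ α β)) (Tensor.≋-sym (Tensor.⋆-assoc (△Hk a) (△H α) (△H β)))

  coeffAt-⋆-△ : ∀ Z y w → Tensor.coeffAt (Z *T △ y) w ≈ ∑ (λ s → proj₁ s * Tensor.coeffAt (Z *T △H (proj₂ s)) w) y
  coeffAt-⋆-△ Z y w =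
    trans (Tensor.at (Tensor.⋆-∑ᴱ Z (map (λ s → proj₁ s ·T △H (proj₂ s)) y)) w)
    (trans (reflexive (P.cong (λ zs → Tensor.coeffAt (ΣT zs) w) (P.sym (LP.map-∘ y))))
    (trans (Tensor.coeffAt-∑ᴱ-map (λ s → Z *T (proj₁ s ·T △H (proj₂ s))) y w)
           (∑-cong (λ s → trans (Tensor.at (Tensor.⋆-•ʳ (proj₁ s) Z (△H (proj₂ s))) w) (Tensor.coeffAt-• (proj₁ s) (Z *T △H (proj₂ s)) w)) y)))

  coeffAt-△-⋆ : ∀ x Y w → Tensor.coeffAt (△ x *T Y) w ≈ ∑ (λ s → proj₁ s * Tensor.coeffAt (△H (proj₂ s) *T Y) w) x
  coeffAt-△-⋆ x Y w =
    trans (Tensor.at (Tensor.∑ᴱ-⋆ (map (λ s → proj₁ s ·T △H (proj₂ s)) x) Y) w)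
    (trans (reflexive (P.cong (λ zs → Tensor.coeffAt (ΣT zs) w) (P.sym (LP.map-∘ x))))
    (trans (Tensor.coeffAt-∑ᴱ-map (λ s → (proj₁ s ·T △H (proj₂ s)) *T Y) x w)
           (∑-cong (λ s → trans (Tensor.at (Tensor.⋆-•ˡ (proj₁ s) (△H (proj₂ s)) Y) w) (Tensor.coeffAt-• (proj₁ s) (△H (proj₂ s) *T Y) w)) x)))

  △-⋆ : ∀ x y → △ (x *N y) ≈ₜ △ x *T △ y
  △-⋆ x y = Tensor.mk≋ λ w → begin
    Tensor.coeffAt (△ (x *N y)) w
      ≈⟨ trans (coeffAt-△ (x *N y) w) (Nsym.∑-⋆ _ x y) ⟩
    ∑ (λ s → ∑ (λ s' → (proj₁ s * proj₁ s') * Tensor.coeffAt (△H (proj₂ s ++ proj₂ s')) w) y) x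
      ≈⟨ ∑-cong (λ s → trans (∑-cong (λ s' → trans (*-assoc _ _ _) (*-congˡ (*-congˡ (Tensor.at (△H-++ (proj₂ s) (proj₂ s')) w)))) y)
                             (∑-*ˡ (proj₁ s) _ y)) x ⟩
    ∑ (λ s → proj₁ s * ∑ (λ s' → proj₁ s' * Tensor.coeffAt (△H (proj₂ s) *T △H (proj₂ s')) w) y) x
      ≈⟨ ∑-cong (λ s → *-congˡ (sym (coeffAt-⋆-△ (△H (proj₂ s)) y w))) x ⟩
    ∑ (λ s → proj₁ s * Tensor.coeffAt (△H (proj₂ s) *T △ y) w) x
      ≈⟨ sym (coeffAt-△-⋆ x (△ y) w) ⟩
    Tensor.coeffAt (△ x *T △ y) w ∎
    where
      open ≈-Reasoning

  △-++ : ∀ x y → △ (x ++ y) ≈ₜ △ x ++ △ y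
  △-++ x y = Tensor.≋-trans (Tensor.≡⇒≋ (P.cong ΣT (LP.map-++ _ x y))) (Tensor.∑ᴱ-++ (map _ x) (map _ y))

  △-• : ∀ a x → △ (a ·N x) ≈ₜ a ·T △ x
  △-• a x = Tensor.mk≋ λ w → trans (coeffAt-△ (a ·N x) w) (trans (reflexive (∑-map _ _ x))
    (trans (∑-cong (λ s → *-assoc _ _ _) x) (trans (∑-*ˡ a _ x) (sym (trans (Tensor.coeffAt-• a (△ x) w) (*-congˡ (coeffAt-△ x w)))))))

  △-H : ∀ α → △ (H α) ≈ₜ △H α
  △-H α = Tensor.≋-trans (Tensor.++-identityʳ _) (Tensor.•-identity (△H α))

  △-1 : △ 1N ≈ₜ 1T
  △-1 = △-H []

  △-Hk : ∀ k → △ (Hk k) ≈T sumHH k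
  △-Hk k = ≈ₜ⇒≈T (Tensor.≋-trans (△-H (k ∷ [])) (Tensor.⋆-identityʳ (△Hk k)))

  ∑-allBits-suc : ∀ {f : List Bool → K} m → ∑ f (allBits (suc m)) ≈ ∑ (λ bs → f (false ∷ bs) + f (true ∷ bs)) (allBits m)
  ∑-allBits-suc {f} m = trans (∑-concatMap f _ (allBits m)) (∑-cong (λ bs → +-congˡ (+-identityʳ _)) (allBits m))

  coeffAt-∑-monomials : ∀ {a} {X : Set a} (f : X → K) (w : X → Comp) xs γ →
    Nsym.coeffAt (ΣN (map (λ J → f J ·N H (w J)) xs)) γ ≈ ∑ (λ J → f J * Nsym.hits (w J) γ) xs
  coeffAt-∑-monomials f w xs γ =
    trans (Nsym.coeffAt-∑ᴱ-map (λ J → f J ·N H (w J)) xs γ) (∑-cong (λ J → trans (+-identityʳ _) (*-congʳ (*-identityʳ _))) xs)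

  H⋆∑-monomials : ∀ {a} {X : Set a} n (f : X → K) (w : X → Comp) xs →
    Hk n *N ΣN (map (λ J → f J ·N H (w J)) xs) ≈ₙ ΣN (map (λ J → f J ·N H (n ∷ w J)) xs)
  H⋆∑-monomials n f w xs = Nsym.≋-trans (Nsym.⋆-∑ᴱ (Hk n) (map (λ J → f J ·N H (w J)) xs))
    (Nsym.≋-trans (Nsym.≡⇒≋ (P.cong ΣN (P.sym (LP.map-∘ xs))))
    (Nsym.∑ᴱ-cong (λ J → Nsym.mk≋ λ γ → +-congʳ (*-congʳ (*-identityˡ _))) xs))

  ∑ᴱ-concatMap : ∀ {a b} {A : Set a} {B : Set b} (F : B → NSym) (g : A → List B) xs →
    ΣN (map F (concatMap g xs)) ≈ₙ ΣN (map (λ x → ΣN (map F (g x))) xs)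
  ∑ᴱ-concatMap F g xs = Nsym.mk≋ λ γ → begin
    Nsym.coeffAt (ΣN (map F (concatMap g xs))) γ         ≈⟨ Nsym.coeffAt-∑ᴱ-map F (concatMap g xs) γ ⟩
    ∑ (λ y → Nsym.coeffAt (F y) γ) (concatMap g xs)       ≈⟨ ∑-concatMap (λ y → Nsym.coeffAt (F y) γ) g xs ⟩
    ∑ (λ x → ∑ (λ y → Nsym.coeffAt (F y) γ) (g x)) xs     ≈⟨ ∑-cong (λ x → sym (Nsym.coeffAt-∑ᴱ-map F (g x) γ)) xs ⟩
    ∑ (λ x → Nsym.coeffAt (ΣN (map F (g x))) γ) xs        ≈⟨ sym (Nsym.coeffAt-∑ᴱ-map (λ x → ΣN (map F (g x))) xs γ) ⟩
    Nsym.coeffAt (ΣN (map (λ x → ΣN (map F (g x))) xs)) γ ∎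
    where
      open ≈-Reasoning

  module Basis (q t : K) where

    open Nsym

    weight : Bool → Bool → K
    weight true true = t
    weight true false = q
    weight false true = 1#
    weight false false = 0#

    weights : List Bool → List Bool → K
    weights (i ∷ I) (j ∷ J) = weight i j * weights I J
    weights [] _ = 1#
    weights (i ∷ I) [] = 1#

    -- 𝓑(q,t) indexed by I, with the first part of every comp(J) enlarged by a - 1.
    B⟨_⟩ : ℕ → List Bool → NSym
    B⟨ a ⟩ I = ΣN (map (λ J → weights I J ·N H (compAux a J)) (allBits (length I)))

    coeffAt-B : ∀ a I γ → coeffAt (B⟨ a ⟩ I) γ ≈ ∑ (λ J → weights I J * hits (compAux a J) γ) (allBits (length I))
    coeffAt-B a I γ = coeffAt-∑-monomials (weights I) (compAux a) (allBits (length I)) γ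

    𝓑bits-coefficient : ∀ I J →
      (if and (zipWith _∨_ I J) then pow q (countT (zipWith (λ i j → i ∧ not j) I J)) * pow t (countT (zipWith _∧_ I J)) else 0#)
      ≈ weights I J
    𝓑bits-coefficient [] J = *-identityˡ _
    𝓑bits-coefficient (i ∷ I) [] = *-identityˡ _
    𝓑bits-coefficient (true ∷ I) (true ∷ J) with and (zipWith _∨_ I J) | 𝓑bits-coefficient I J
    ... | true | e = trans (solve 3 (λ a t b → a :* (t :* b) := t :* (a :* b)) refl _ t _) (*-congˡ e)
    ... | false | e = trans (sym (zeroʳ t)) (*-congˡ e)
    𝓑bits-coefficient (true ∷ I) (false ∷ J) with and (zipWith _∨_ I J) | 𝓑bits-coefficient I J
    ... | true | e = trans (*-assoc _ _ _) (*-congˡ e)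
    ... | false | e = trans (sym (zeroʳ q)) (*-congˡ e)
    𝓑bits-coefficient (false ∷ I) (true ∷ J) = trans (𝓑bits-coefficient I J) (sym (*-identityˡ _))
    𝓑bits-coefficient (false ∷ I) (false ∷ J) = sym (zeroˡ _)

    𝓑bits≈B⟨1⟩ : ∀ I → 𝓑bits q t I ≈ₙ B⟨ 1 ⟩ I
    𝓑bits≈B⟨1⟩ I = mk≋ λ γ →
      trans (coeffAt-∑-monomials _ compOf (filterᵇ _ (allBits (length I))) γ)
      (trans (∑-filterᵇ _ _ (allBits (length I)))
      (trans (∑-cong (λ J → if-cong (and (zipWith _∨_ I J)) (𝓑bits-coefficient I J)) (allBits (length I)))
             (sym (coeffAt-B 1 I γ))))
      where
      if-cong : ∀ {w f i} b → (if b then w else 0#) ≈ f → (if b then w * i else 0#) ≈ f * i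
      if-cong true e = *-congʳ e
      if-cong {i = i} false e = trans (sym (zeroˡ i)) (*-congʳ e)

    B⟨⟩-[] : ∀ a → B⟨ a ⟩ [] ≈ₙ Hk a
    B⟨⟩-[] a = mk≋ λ γ → coeffAt-B a [] γ

    -- Expanding the first bit of J: either it merges into the first part, or it closes a part of size a.
    B⟨⟩-∷ : ∀ a i I → B⟨ a ⟩ (i ∷ I) ≈ₙ weight i false ·N B⟨ suc a ⟩ I ++ weight i true ·N (Hk a *N B⟨ 1 ⟩ I)
    B⟨⟩-∷ a i I = mk≋ λ γ → begin
      coeffAt (B⟨ a ⟩ (i ∷ I)) γ
        ≈⟨ trans (coeffAt-B a (i ∷ I) γ) (∑-allBits-suc (length I)) ⟩
      ∑ (λ J → (weight i false * weights I J) * hits (compAux (suc a) J) γ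
             + (weight i true * weights I J) * hits (a ∷ compAux 1 J) γ) (allBits (length I))
        ≈⟨ trans (∑-+ _ _ (allBits (length I))) (+-cong (pull (weight i false)) (pull (weight i true))) ⟩
      weight i false * ∑ (λ J → weights I J * hits (compAux (suc a) J) γ) (allBits (length I))
        + weight i true * ∑ (λ J → weights I J * hits (a ∷ compAux 1 J) γ) (allBits (length I))
        ≈⟨ +-cong (*-congˡ (sym (coeffAt-B (suc a) I γ)))
                  (*-congˡ (sym (trans (at (H⋆∑-monomials a (weights I) (compAux 1) (allBits (length I))) γ)
                                       (coeffAt-∑-monomials (weights I) (λ J → a ∷ compAux 1 J) (allBits (length I)) γ)))) ⟩
      weight i false * coeffAt (B⟨ suc a ⟩ I) γ + weight i true * coeffAt (Hk a *N B⟨ 1 ⟩ I) γ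
        ≈⟨ sym (trans (coeffAt-++ (weight i false ·N B⟨ suc a ⟩ I) _ γ)
                      (+-cong (coeffAt-• _ (B⟨ suc a ⟩ I) γ) (coeffAt-• _ (Hk a *N B⟨ 1 ⟩ I) γ))) ⟩
      coeffAt (weight i false ·N B⟨ suc a ⟩ I ++ weight i true ·N (Hk a *N B⟨ 1 ⟩ I)) γ ∎
      where
      open ≈-Reasoning
      pull : ∀ w {g : List Bool → K} → ∑ (λ J → (w * weights I J) * g J) (allBits (length I)) ≈ w * ∑ (λ J → weights I J * g J) (allBits (length I))
      pull w = trans (∑-cong (λ J → *-assoc _ _ _) (allBits (length I))) (∑-*ˡ w _ (allBits (length I)))

    B⟨⟩-split : ∀ a I I' → B⟨ a ⟩ (I ++ false ∷ I') ≈ₙ B⟨ a ⟩ I *N B⟨ 1 ⟩ I'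
    B⟨⟩-split a [] I' = begin
      B⟨ a ⟩ (false ∷ I')                                       ≈⟨ B⟨⟩-∷ a false I' ⟩
      0# ·N B⟨ suc a ⟩ I' ++ 1# ·N (Hk a *N B⟨ 1 ⟩ I')           ≈⟨ ++-cong (•-zero (B⟨ suc a ⟩ I')) (•-identity (Hk a *N B⟨ 1 ⟩ I')) ⟩
      Hk a *N B⟨ 1 ⟩ I'                                          ≈⟨ ⋆-cong (≋-sym (B⟨⟩-[] a)) ≋-refl ⟩
      B⟨ a ⟩ [] *N B⟨ 1 ⟩ I'                                     ∎
      where
        open ≋-Reasoning
    B⟨⟩-split a (i ∷ I) I' = begin
      B⟨ a ⟩ (i ∷ I ++ false ∷ I')
        ≈⟨ B⟨⟩-∷ a i (I ++ false ∷ I') ⟩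
      wᶠ ·N B⟨ suc a ⟩ (I ++ false ∷ I') ++ wᵗ ·N (Hk a *N B⟨ 1 ⟩ (I ++ false ∷ I'))
        ≈⟨ ++-cong (•-congˡ wᶠ (B⟨⟩-split (suc a) I I'))
                   (•-congˡ wᵗ (≋-trans (⋆-cong (≋-refl {Hk a}) (B⟨⟩-split 1 I I')) (≋-sym (⋆-assoc (Hk a) (B⟨ 1 ⟩ I) (B⟨ 1 ⟩ I'))))) ⟩
      wᶠ ·N (B⟨ suc a ⟩ I *N B⟨ 1 ⟩ I') ++ wᵗ ·N ((Hk a *N B⟨ 1 ⟩ I) *N B⟨ 1 ⟩ I')
        ≈⟨ ++-cong (≋-sym (⋆-•ˡ wᶠ (B⟨ suc a ⟩ I) (B⟨ 1 ⟩ I'))) (≋-sym (⋆-•ˡ wᵗ (Hk a *N B⟨ 1 ⟩ I) (B⟨ 1 ⟩ I'))) ⟩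
      (wᶠ ·N B⟨ suc a ⟩ I) *N B⟨ 1 ⟩ I' ++ (wᵗ ·N (Hk a *N B⟨ 1 ⟩ I)) *N B⟨ 1 ⟩ I'
        ≈⟨ ≋-sym (⋆-distribʳ (wᶠ ·N B⟨ suc a ⟩ I) (wᵗ ·N (Hk a *N B⟨ 1 ⟩ I)) (B⟨ 1 ⟩ I')) ⟩
      (wᶠ ·N B⟨ suc a ⟩ I ++ wᵗ ·N (Hk a *N B⟨ 1 ⟩ I)) *N B⟨ 1 ⟩ I'
        ≈⟨ ⋆-cong (≋-sym (B⟨⟩-∷ a i I)) ≋-refl ⟩
      B⟨ a ⟩ (i ∷ I) *N B⟨ 1 ⟩ I' ∎
      where
      open ≋-Reasoning
      wᶠ wᵗ : K
      wᶠ = weight i false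
      wᵗ = weight i true

    𝓑-compOf : ∀ bs → 𝓑 q t (compOf bs) ≡ 𝓑bits q t bs
    𝓑-compOf bs with compOf bs | compAux-nonempty 1 bs | setBits-compOf bs
    ... | .(h ∷ tl) | h , tl , P.refl | e = P.cong (𝓑bits q t) e

    𝓑̂≈B⟨1⟩ : ∀ x α → 𝓑̂ q t (x ∷ α) ≈ₙ B⟨ 1 ⟩ (map not (setBits (x ∷ α)))
    𝓑̂≈B⟨1⟩ x α rewrite 𝓑-compOf (map not (setBits (x ∷ α))) = 𝓑bits≈B⟨1⟩ (map not (setBits (x ∷ α)))

    -- A cut between α and β is a position missing from the complement, where B⟨ 1 ⟩ factorises.
    𝓑̂-⋆ : ∀ α β → 𝓑̂ q t α *N 𝓑̂ q t β ≈ₙ 𝓑̂ q t (α ++ β)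
    𝓑̂-⋆ [] β = ⋆-identityˡ (𝓑̂ q t β)
    𝓑̂-⋆ (x ∷ α) [] rewrite LP.++-identityʳ α = ⋆-identityʳ (𝓑̂ q t (x ∷ α))
    𝓑̂-⋆ (x ∷ α) (y ∷ β) = begin
      𝓑̂ q t (x ∷ α) *N 𝓑̂ q t (y ∷ β)          ≈⟨ ⋆-cong (𝓑̂≈B⟨1⟩ x α) (𝓑̂≈B⟨1⟩ y β) ⟩
      B⟨ 1 ⟩ Iα *N B⟨ 1 ⟩ Iβ                    ≈⟨ ≋-sym (B⟨⟩-split 1 Iα Iβ) ⟩
      B⟨ 1 ⟩ (Iα ++ false ∷ Iβ)                 ≡⟨ P.cong B⟨ 1 ⟩ (P.sym complement-++) ⟩
      B⟨ 1 ⟩ (map not (setBits (x ∷ α ++ y ∷ β))) ≈⟨ ≋-sym (𝓑̂≈B⟨1⟩ x (α ++ y ∷ β)) ⟩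
      𝓑̂ q t (x ∷ α ++ y ∷ β)                   ∎
      where
      open ≋-Reasoning
      Iα Iβ : List Bool
      Iα = map not (setBits (x ∷ α))
      Iβ = map not (setBits (y ∷ β))
      complement-++ : map not (setBits ((x ∷ α) ++ y ∷ β)) ≡ Iα ++ false ∷ Iβ
      complement-++ = P.trans (P.cong (map not) (setBits-++ x α y β)) (LP.map-++ not (setBits (x ∷ α)) _)

    𝓑̂-multiplicative : ∀ α β → IsComp α → IsComp β → (𝓑̂ q t α *N 𝓑̂ q t β) ≈N 𝓑̂ q t (α ++ β)
    𝓑̂-multiplicative α β _ _ = ≈ₙ⇒≈N (𝓑̂-⋆ α β)

    𝓑̂k≈B⟨1⟩ : ∀ n → 𝓑̂k q t (suc n) ≈ₙ B⟨ 1 ⟩ (replicate n true)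
    𝓑̂k≈B⟨1⟩ n = ≋-trans (𝓑̂≈B⟨1⟩ (suc n) []) (≡⇒≋ (P.cong B⟨ 1 ⟩ (LP.map-replicate not n false)))

    -- Inclusion–exclusion: in the (-t)-weighted sum of the B⟨ a ⟩ (¬ J) everything cancels except qᵐ H_{a+m}.
    alternatingSum : ℕ → ℕ → NSym
    alternatingSum a m = ΣN (map (λ J → pow (- t) (countT J) ·N B⟨ a ⟩ (map not J)) (allBits m))

    alternatingPair : ∀ a bs →
      ΣN (map (λ J → pow (- t) (countT J) ·N B⟨ a ⟩ (map not J)) ((false ∷ bs) ∷ (true ∷ bs) ∷ []))
        ≈ₙ q ·N (pow (- t) (countT bs) ·N B⟨ suc a ⟩ (map not bs))
    alternatingPair a bs = mk≋ pairAt
      where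
      κ : K
      κ = pow (- t) (countT bs)
      X Y : NSym
      X = B⟨ suc a ⟩ (map not bs)
      Y = Hk a *N B⟨ 1 ⟩ (map not bs)
      cancel : ∀ x y → κ * (q * x + t * y) + (((- t) * κ) * (0# * x + 1# * y) + 0#) ≈ q * (κ * x)
      cancel x y = begin
        κ * (q * x + t * y) + (((- t) * κ) * (0# * x + 1# * y) + 0#)
          ≈⟨ +-cong (solve 5 (λ κ q t x y → κ :* (q :* x :+ t :* y) := q :* (κ :* x) :+ (t :* κ) :* y) refl κ q t x y)
                    (trans (+-identityʳ _) (*-cong (sym (-‿distribˡ-* t κ)) (trans (+-cong (zeroˡ x) (*-identityˡ y)) (+-identityˡ y)))) ⟩
        (q * (κ * x) + (t * κ) * y) + (- (t * κ)) * y ≈⟨ +-assoc _ _ _ ⟩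
        q * (κ * x) + ((t * κ) * y + (- (t * κ)) * y) ≈⟨ +-congˡ (trans (sym (distribʳ y _ _)) (trans (*-congʳ (-‿inverseʳ _)) (zeroˡ y))) ⟩
        q * (κ * x) + 0#                              ≈⟨ +-identityʳ _ ⟩
        q * (κ * x)                                   ∎
        where
          open ≈-Reasoning
      pairAt : ∀ γ → coeffAt (ΣN (map (λ J → pow (- t) (countT J) ·N B⟨ a ⟩ (map not J)) ((false ∷ bs) ∷ (true ∷ bs) ∷ []))) γ
                     ≈ coeffAt (q ·N (κ ·N X)) γ
      pairAt γ = begin
        coeffAt (ΣN (map (λ J → pow (- t) (countT J) ·N B⟨ a ⟩ (map not J)) ((false ∷ bs) ∷ (true ∷ bs) ∷ []))) γ
          ≈⟨ trans (coeffAt-++ (κ ·N B⟨ a ⟩ (true ∷ map not bs)) _ γ)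
                   (+-congˡ (coeffAt-++ (((- t) * κ) ·N B⟨ a ⟩ (false ∷ map not bs)) [] γ)) ⟩
        coeffAt (κ ·N B⟨ a ⟩ (true ∷ map not bs)) γ + (coeffAt (((- t) * κ) ·N B⟨ a ⟩ (false ∷ map not bs)) γ + 0#)
          ≈⟨ +-cong (trans (coeffAt-• κ (B⟨ a ⟩ (true ∷ map not bs)) γ) (*-congˡ (expand true)))
                    (+-congʳ (trans (coeffAt-• ((- t) * κ) (B⟨ a ⟩ (false ∷ map not bs)) γ) (*-congˡ (expand false)))) ⟩
        κ * (q * x + t * y) + (((- t) * κ) * (0# * x + 1# * y) + 0#)
          ≈⟨ cancel x y ⟩
        q * (κ * x)
          ≈⟨ sym (trans (coeffAt-• q (κ ·N X) γ) (*-congˡ (coeffAt-• κ X γ))) ⟩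
        coeffAt (q ·N (κ ·N X)) γ ∎
        where
        open ≈-Reasoning
        x y : K
        x = coeffAt X γ
        y = coeffAt Y γ
        expand : ∀ i → coeffAt (B⟨ a ⟩ (i ∷ map not bs)) γ ≈ weight i false * x + weight i true * y
        expand i = trans (at (B⟨⟩-∷ a i (map not bs)) γ)
          (trans (coeffAt-++ (weight i false ·N X) (weight i true ·N Y) γ) (+-cong (coeffAt-• _ X γ) (coeffAt-• _ Y γ)))

    alternatingSum≈ : ∀ a m → alternatingSum a m ≈ₙ pow q m ·N Hk (a ℕ.+ m)
    alternatingSum≈ a zero =
      ≋-trans (++-identityʳ _) (≋-trans (•-identity (B⟨ a ⟩ [])) (≋-trans (B⟨⟩-[] a)
        (≋-trans (≋-sym (•-identity (Hk a))) (≡⇒≋ (P.cong (λ n → 1# ·N Hk n) (P.sym (ℕP.+-identityʳ a)))))))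
    alternatingSum≈ a (suc m) = begin
      alternatingSum a (suc m)
        ≈⟨ ∑ᴱ-concatMap term _ (allBits m) ⟩
      ΣN (map (λ bs → ΣN (map term ((false ∷ bs) ∷ (true ∷ bs) ∷ []))) (allBits m))
        ≈⟨ ∑ᴱ-cong (alternatingPair a) (allBits m) ⟩
      ΣN (map (λ bs → q ·N term' bs) (allBits m))
        ≡⟨ P.cong ΣN (LP.map-∘ (allBits m)) ⟩
      ΣN (map (q ·N_) (map term' (allBits m)))
        ≈⟨ ≋-sym (•-∑ᴱ q (map term' (allBits m))) ⟩
      q ·N alternatingSum (suc a) m
        ≈⟨ •-congˡ q (alternatingSum≈ (suc a) m) ⟩
      q ·N (pow q m ·N Hk (suc a ℕ.+ m))
        ≈⟨ •-assoc q (pow q m) _ ⟩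
      pow q (suc m) ·N Hk (suc a ℕ.+ m)
        ≡⟨ P.cong (λ n → pow q (suc m) ·N Hk n) (P.sym (ℕP.+-suc a m)) ⟩
      pow q (suc m) ·N Hk (a ℕ.+ suc m) ∎
      where
      open ≋-Reasoning
      term term' : List Bool → NSym
      term J = pow (- t) (countT J) ·N B⟨ a ⟩ (map not J)
      term' J = pow (- t) (countT J) ·N B⟨ suc a ⟩ (map not J)

    𝓑̂-word : Comp → NSym
    𝓑̂-word w = prodN (map (𝓑̂k q t) w)

    evalTerm : K × Comp → NSym
    evalTerm s = proj₁ s ·N 𝓑̂-word (proj₂ s)

    prodN-++ : ∀ xs ys → prodN (xs ++ ys) ≈ₙ prodN xs *N prodN ys
    prodN-++ [] ys = ≋-sym (⋆-identityˡ (prodN ys))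
    prodN-++ (x ∷ xs) ys =
      ≋-trans (⋆-cong (≋-refl {x}) (prodN-++ xs ys)) (≋-sym (⋆-assoc x (prodN xs) (prodN ys)))

    𝓑̂-word-++ : ∀ w w' → 𝓑̂-word (w ++ w') ≈ₙ 𝓑̂-word w *N 𝓑̂-word w'
    𝓑̂-word-++ w w' = ≋-trans (≡⇒≋ (P.cong prodN (LP.map-++ (𝓑̂k q t) w w'))) (prodN-++ (map (𝓑̂k q t) w) (map (𝓑̂k q t) w'))

    𝓑̂-word≈𝓑̂ : ∀ w → IsComp w → 𝓑̂-word w ≈ₙ 𝓑̂ q t w
    𝓑̂-word≈𝓑̂ [] _ = ≋-refl
    𝓑̂-word≈𝓑̂ (suc n ∷ w) (_ ∷ w-isComp) =
      ≋-trans (⋆-cong (≋-refl {𝓑̂k q t (suc n)}) (𝓑̂-word≈𝓑̂ w w-isComp)) (𝓑̂-⋆ (suc n ∷ []) w)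

    evalGen-++ : ∀ p p' → evalGen q t (p ++ p') ≈ₙ evalGen q t p ++ evalGen q t p'
    evalGen-++ p p' = ≋-trans (≡⇒≋ (P.cong ΣN (LP.map-++ evalTerm p p'))) (∑ᴱ-++ (map evalTerm p) (map evalTerm p'))

    evalGen-• : ∀ a p → evalGen q t (a ·N p) ≈ₙ a ·N evalGen q t p
    evalGen-• a p = ≋-trans (≡⇒≋ (P.cong ΣN (P.sym (LP.map-∘ p))))
      (≋-trans (∑ᴱ-cong (λ s → ≋-sym (•-assoc a (proj₁ s) (𝓑̂-word (proj₂ s)))) p)
      (≋-trans (≡⇒≋ (P.cong ΣN (LP.map-∘ p))) (≋-sym (•-∑ᴱ a (map evalTerm p)))))

    evalGen-⋆ : ∀ p p' → evalGen q t (p *N p') ≈ₙ evalGen q t p *N evalGen q t p'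
    evalGen-⋆ p p' = ≋-trans (∑ᴱ-concatMap evalTerm _ p)
      (≋-trans (∑ᴱ-cong termwise p)
      (≋-trans (≡⇒≋ (P.cong ΣN (LP.map-∘ p))) (≋-sym (∑ᴱ-⋆ (map evalTerm p) (evalGen q t p')))))
      where
      termwise : ∀ s → ΣN (map evalTerm (map (λ s' → (proj₁ s * proj₁ s' , proj₂ s ++ proj₂ s')) p')) ≈ₙ evalTerm s *N evalGen q t p'
      termwise s = ≋-trans (≡⇒≋ (P.cong ΣN (P.sym (LP.map-∘ p'))))
        (≋-trans (∑ᴱ-cong (λ s' →
             ≋-trans (•-congˡ _ (𝓑̂-word-++ (proj₂ s) (proj₂ s')))
             (≋-trans (≋-sym (•-assoc (proj₁ s) (proj₁ s') _))
             (≋-trans (•-congˡ (proj₁ s) (≋-sym (⋆-•ʳ (proj₁ s') (𝓑̂-word (proj₂ s)) (𝓑̂-word (proj₂ s')))))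
                           (≋-sym (⋆-•ˡ (proj₁ s) (𝓑̂-word (proj₂ s)) (evalTerm s')))))) p')
        (≋-trans (≡⇒≋ (P.cong ΣN (LP.map-∘ p'))) (≋-sym (⋆-∑ᴱ (evalTerm s) (map evalTerm p')))))

    evalGen-1 : evalGen q t 1N ≈ₙ 1N
    evalGen-1 = ≋-trans (++-identityʳ _) (•-identity 1N)

    𝓑̂-compOf : ∀ J → 𝓑̂ q t (compOf J) ≈ₙ B⟨ 1 ⟩ (map not J)
    𝓑̂-compOf J with compOf J | compAux-nonempty 1 J | setBits-compOf J
    ... | .(h ∷ tl) | h , tl , P.refl | e = ≋-trans (𝓑̂≈B⟨1⟩ h tl) (≡⇒≋ (P.cong (λ z → B⟨ 1 ⟩ (map not z)) e))

    module _ (u : K) (q*u≈1 : q * u ≈ 1#) where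

      Hk-preimage : ℕ → GenPoly
      Hk-preimage zero = 1N
      Hk-preimage (suc m) = map (λ J → (pow u m * pow (- t) (countT J) , compOf J)) (allBits m)

      Hk-preimage-correct : ∀ n → evalGen q t (Hk-preimage n) ≈ₙ Hk n
      Hk-preimage-correct zero = ≋-trans evalGen-1 (≋-sym H0≈1)
      Hk-preimage-correct (suc m) = begin
        evalGen q t (Hk-preimage (suc m))
          ≡⟨ P.cong ΣN (P.sym (LP.map-∘ (allBits m))) ⟩
        ΣN (map (λ J → (pow u m * pow (- t) (countT J)) ·N 𝓑̂-word (compOf J)) (allBits m))
          ≈⟨ ∑ᴱ-cong (λ J → ≋-trans (•-congˡ _ (≋-trans (𝓑̂-word≈𝓑̂ (compOf J) (compAux-isComp 0 J)) (𝓑̂-compOf J)))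
                                     (≋-sym (•-assoc (pow u m) (pow (- t) (countT J)) (B⟨ 1 ⟩ (map not J))))) (allBits m) ⟩
        ΣN (map (λ J → pow u m ·N (pow (- t) (countT J) ·N B⟨ 1 ⟩ (map not J))) (allBits m))
          ≡⟨ P.cong ΣN (LP.map-∘ (allBits m)) ⟩
        ΣN (map (pow u m ·N_) (map (λ J → pow (- t) (countT J) ·N B⟨ 1 ⟩ (map not J)) (allBits m)))
          ≈⟨ ≋-sym (•-∑ᴱ (pow u m) (map (λ J → pow (- t) (countT J) ·N B⟨ 1 ⟩ (map not J)) (allBits m))) ⟩
        pow u m ·N alternatingSum 1 m
          ≈⟨ •-congˡ (pow u m) (alternatingSum≈ 1 m) ⟩
        pow u m ·N (pow q m ·N Hk (suc m))
          ≈⟨ •-assoc (pow u m) (pow q m) _ ⟩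
        (pow u m * pow q m) ·N Hk (suc m)
          ≈⟨ •-cong u^m*q^m≈1 ≋-refl ⟩
        1# ·N Hk (suc m)
          ≈⟨ •-identity _ ⟩
        Hk (suc m) ∎
        where
        open ≋-Reasoning
        u^m*q^m≈1 : pow u m * pow q m ≈ 1#
        u^m*q^m≈1 = trans (pow-* u q m) (trans (pow-cong m (trans (*-comm u q) q*u≈1)) (pow-1# m))

      H-preimage : Comp → GenPoly
      H-preimage [] = 1N
      H-preimage (n ∷ α) = Hk-preimage n *N H-preimage α

      H-preimage-correct : ∀ α → evalGen q t (H-preimage α) ≈ₙ H α
      H-preimage-correct [] = evalGen-1
      H-preimage-correct (n ∷ α) = ≋-trans (evalGen-⋆ (Hk-preimage n) (H-preimage α))
        (≋-trans (⋆-cong (Hk-preimage-correct n) (H-preimage-correct α)) (mk≋ λ γ → +-congʳ (*-congʳ (*-identityˡ _))))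

      preimage : NSym → GenPoly
      preimage = concatMap (λ s → proj₁ s ·N H-preimage (proj₂ s))

      preimage-correct : ∀ x → evalGen q t (preimage x) ≈ₙ x
      preimage-correct [] = ≋-refl
      preimage-correct ((a , α) ∷ x) = ≋-trans (evalGen-++ (a ·N H-preimage α) (preimage x))
        (++-cong {y' = x} (≋-trans (evalGen-• a (H-preimage α))
          (≋-trans (•-congˡ a (H-preimage-correct α)) (mk≋ λ γ → +-congʳ (*-congʳ (*-identityʳ a)))))
          (preimage-correct x))

    generates : (∃ λ u → q * u ≈ 1#) → Generates q t
    generates (u , q*u≈1) x = preimage u q*u≈1 x , ≈ₙ⇒≈N (preimage-correct u q*u≈1 x)

    B⟨⟩-trues : t ≈ 0# → ∀ a n → B⟨ a ⟩ (replicate n true) ≈ₙ pow q n ·N Hk (a ℕ.+ n)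
    B⟨⟩-trues t≈0 a zero =
      ≋-trans (B⟨⟩-[] a) (≋-trans (≋-sym (•-identity (Hk a))) (≡⇒≋ (P.cong (λ n → 1# ·N Hk n) (P.sym (ℕP.+-identityʳ a)))))
    B⟨⟩-trues t≈0 a (suc n) = ≋-trans (B⟨⟩-∷ a true (replicate n true))
      (≋-trans (++-cong (•-congˡ q (B⟨⟩-trues t≈0 (suc a) n)) (•-cong t≈0 (≋-refl {Hk a *N B⟨ 1 ⟩ (replicate n true)})))
      (≋-trans (++-cong (•-assoc q (pow q n) (Hk (suc a ℕ.+ n))) (•-zero (Hk a *N B⟨ 1 ⟩ (replicate n true))))
      (≋-trans (++-identityʳ _) (≡⇒≋ (P.cong (λ m → pow q (suc n) ·N Hk m) (P.sym (ℕP.+-suc a n)))))))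

  𝓑̂k-1-0≈Hk : ∀ k → 𝓑̂k 1# 0# k ≈N Hk k
  𝓑̂k-1-0≈Hk zero γ = refl
  𝓑̂k-1-0≈Hk (suc n) = ≈ₙ⇒≈N (Nsym.≋-trans (𝓑̂k≈B⟨1⟩ n)
    (Nsym.≋-trans (B⟨⟩-trues refl 1 n) (Nsym.≋-trans (Nsym.•-cong (pow-1# n) Nsym.≋-refl) (Nsym.•-identity (Hk (suc n))))))
    where
      open Basis 1# 0#

  replicate-false-⊆ : ∀ n J → subsetB (replicate n false) J ≡ true
  replicate-false-⊆ zero J = P.refl
  replicate-false-⊆ (suc n) [] = P.refl
  replicate-false-⊆ (suc n) (j ∷ J) = replicate-false-⊆ n J

  𝓑̂k-minus1-1≈Λk : ∀ k → 𝓑̂k (- 1#) 1# k ≈N Λk k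
  𝓑̂k-minus1-1≈Λk zero γ = refl
  𝓑̂k-minus1-1≈Λk (suc n) = ≈ₙ⇒≈N {y = Λk (suc n)} (Nsym.≋-trans (𝓑̂k≈B⟨1⟩ n) (Nsym.mk≋ λ γ → begin
    Nsym.coeffAt (B⟨ 1 ⟩ (replicate n true)) γ
      ≈⟨ coeffAt-B 1 (replicate n true) γ ⟩
    ∑ (λ J → weights (replicate n true) J * Nsym.hits (compOf J) γ) (allBits (length (replicate n true)))
      ≡⟨ P.cong (λ m → ∑ (λ J → weights (replicate n true) J * Nsym.hits (compOf J) γ) (allBits m)) (LP.length-replicate n) ⟩
    ∑ (λ J → weights (replicate n true) J * Nsym.hits (compOf J) γ) (allBits n)
      ≈⟨ ∑-cong-All (All.map (λ {J} |J|≡n → *-congʳ (sign J |J|≡n)) (allBits-length n)) ⟩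
    ∑ (λ J → signOf J * Nsym.hits (compOf J) γ) (allBits n)
      ≡⟨ P.cong (∑ (λ J → signOf J * Nsym.hits (compOf J) γ))
                (P.sym (P.trans (filterᵇ-all _ (replicate-false-⊆ n) _) (P.cong allBits (LP.length-replicate n)))) ⟩
    ∑ (λ J → signOf J * Nsym.hits (compOf J) γ) (filterᵇ (subsetB (replicate n false)) (allBits (length (replicate n false))))
      ≈⟨ sym (coeffAt-∑-monomials signOf compOf (filterᵇ (subsetB (replicate n false)) (allBits (length (replicate n false)))) γ) ⟩
    Nsym.coeffAt (Λk (suc n)) γ ∎))
    where
    open ≈-Reasoning
    open Basis (- 1#) 1#
    signOf : List Bool → K
    signOf J = pow (- 1#) (size (suc n ∷ []) ∸ length (compOf J))
    weights-trues : ∀ J → weights (replicate (length J) true) J ≈ pow (- 1#) (length J ∸ countT J)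
    weights-trues [] = refl
    weights-trues (true ∷ J) = trans (*-identityˡ _) (weights-trues J)
    weights-trues (false ∷ J) = trans (*-congˡ (weights-trues J)) (reflexive (P.cong (pow (- 1#)) (P.sym (ℕP.+-∸-assoc 1 (countT≤length J)))))
    sign : ∀ J → length J ≡ n → weights (replicate n true) J ≈ signOf J
    sign J P.refl rewrite length-compAux 1 J | ℕP.+-identityʳ (length J) = weights-trues J

  record IsAlgebraMap (f : NSym → T) : Set (c Level.⊔ ℓ) where
    field
      cong : ∀ {x y} → x ≈ₙ y → f x ≈ₜ f y
      ++-homo : ∀ x y → f (x ++ y) ≈ₜ f x ++ f y
      ⋆-homo : ∀ x y → f (x *N y) ≈ₜ f x *T f y
      1-homo : f 1N ≈ₜ 1T
      •-homo : ∀ a x → f (a ·N x) ≈ₜ a ·T f x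

    []-homo : f [] ≈ₜ []
    []-homo = Tensor.≋-trans (•-homo 0# []) (Tensor.•-zero (f []))

    conv-homo : ∀ U V n → f (Nsym.conv U V n) ≈ₜ Tensor.conv (f ∘ U) (f ∘ V) n
    conv-homo U V zero = ⋆-homo (U 0) (V 0)
    conv-homo U V (suc k) = Tensor.≋-trans (++-homo _ _) (Tensor.++-cong (⋆-homo (U 0) (V (suc k))) (conv-homo (Nsym.shift U) V k))

  embedˡ embedʳ : NSym → T
  embedˡ x = x ⊗ 1N
  embedʳ x = 1N ⊗ x

  embedˡ-isAlgebraMap : IsAlgebraMap embedˡ
  embedˡ-isAlgebraMap = record
    { cong = λ e → ⊗-cong e (Nsym.≋-refl {1N})
    ; ++-homo = λ x y → ⊗-++ˡ x y 1N
    ; ⋆-homo = λ x y → Tensor.≋-sym (Tensor.≋-trans (⊗-⋆ x 1N y 1N) (⊗-cong (Nsym.≋-refl {x *N y}) (Nsym.⋆-identityˡ 1N)))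
    ; 1-homo = 1⊗1≈1
    ; •-homo = λ a x → ⊗-•ˡ a x 1N
    }

  embedʳ-isAlgebraMap : IsAlgebraMap embedʳ
  embedʳ-isAlgebraMap = record
    { cong = λ e → ⊗-cong (Nsym.≋-refl {1N}) e
    ; ++-homo = λ x y → ⊗-++ʳ 1N x y
    ; ⋆-homo = λ x y → Tensor.≋-sym (Tensor.≋-trans (⊗-⋆ 1N x 1N y) (⊗-cong (Nsym.⋆-identityˡ 1N) (Nsym.≋-refl {x *N y})))
    ; 1-homo = 1⊗1≈1
    ; •-homo = λ a x → ⊗-•ʳ a 1N x
    }

  △-isAlgebraMap : IsAlgebraMap △
  △-isAlgebraMap = record { cong = △-cong ; ++-homo = △-++ ; ⋆-homo = △-⋆ ; 1-homo = △-1 ; •-homo = △-• }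

  module Coproduct (q t : K) where
    open Basis q t
    open Tensor

    qH : ℕ → NSym
    qH zero = []
    qH (suc n) = pow q n ·N Hk (suc n)

    1+t𝓑̂ : ℕ → NSym
    1+t𝓑̂ zero = 1N
    1+t𝓑̂ (suc n) = t ·N 𝓑̂k q t (suc n)

    conv-qH-shifted : ∀ r m → Nsym.conv (λ k → qH (suc r ℕ.+ k)) 1+t𝓑̂ m ≈ₙ pow q r ·N B⟨ suc r ⟩ (replicate m true)
    conv-qH-shifted r zero = Nsym.≋-trans (Nsym.⋆-identityʳ _)
      (Nsym.≋-trans (Nsym.≡⇒≋ (P.cong qH (P.cong suc (ℕP.+-identityʳ r)))) (Nsym.•-congˡ _ (Nsym.≋-sym (B⟨⟩-[] (suc r)))))
    conv-qH-shifted r (suc m) = Nsym.≋-trans (Nsym.++-cong first rest) (Nsym.≋-sym expanded)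
      where
      X Y : NSym
      X = B⟨ suc (suc r) ⟩ (replicate m true)
      Y = Hk (suc r) *N B⟨ 1 ⟩ (replicate m true)
      first : qH (suc r ℕ.+ 0) *N 1+t𝓑̂ (suc m) ≈ₙ (pow q r * t) ·N Y
      first = Nsym.≋-trans (Nsym.⋆-cong (Nsym.≡⇒≋ (P.cong qH (P.cong suc (ℕP.+-identityʳ r)))) (Nsym.•-congˡ t (𝓑̂k≈B⟨1⟩ m)))
        (Nsym.≋-trans (Nsym.⋆-•ˡ (pow q r) (Hk (suc r)) (t ·N B⟨ 1 ⟩ (replicate m true)))
        (Nsym.≋-trans (Nsym.•-congˡ _ (Nsym.⋆-•ʳ t (Hk (suc r)) (B⟨ 1 ⟩ (replicate m true)))) (Nsym.•-assoc (pow q r) t Y)))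
      rest : Nsym.conv (λ k → qH (suc r ℕ.+ suc k)) 1+t𝓑̂ m ≈ₙ (pow q r * q) ·N X
      rest = Nsym.≋-trans (Nsym.conv-congˡ 1+t𝓑̂ (λ k → Nsym.≡⇒≋ (P.cong qH (P.cong suc (ℕP.+-suc r k)))) m)
        (Nsym.≋-trans (conv-qH-shifted (suc r) m) (Nsym.•-cong (*-comm q (pow q r)) Nsym.≋-refl))
      expanded : pow q r ·N B⟨ suc r ⟩ (replicate (suc m) true) ≈ₙ (pow q r * t) ·N Y ++ (pow q r * q) ·N X
      expanded = Nsym.≋-trans (Nsym.•-congˡ _ (B⟨⟩-∷ (suc r) true (replicate m true)))
        (Nsym.≋-trans (Nsym.•-++ (pow q r) (q ·N X) (t ·N Y))
        (Nsym.≋-trans (Nsym.++-cong (Nsym.•-assoc (pow q r) q X) (Nsym.•-assoc (pow q r) t Y)) (Nsym.++-comm ((pow q r * q) ·N X) ((pow q r * t) ·N Y))))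

    -- Splitting off the first part of comp(J): 𝓑̂ₘ₊₁ = Σᵢ qⁱ Hᵢ₊₁ (δ + t 𝓑̂)ₘ₋ᵢ.
    𝓑̂k≈conv : ∀ m → 𝓑̂k q t (suc m) ≈ₙ Nsym.conv qH 1+t𝓑̂ (suc m)
    𝓑̂k≈conv m = Nsym.≋-trans (𝓑̂k≈B⟨1⟩ m) (Nsym.≋-trans (Nsym.≋-sym (Nsym.•-identity _)) (Nsym.≋-sym (conv-qH-shifted 0 m)))

    image : (NSym → T) → ℕ → T
    image f zero = []
    image f (suc n) = f (𝓑̂k q t (suc n))

    image-recursion : ∀ {f} → IsAlgebraMap f → image f ≋ˢ conv (f ∘ qH) (𝟏ˢ ⊕ t •ˢ image f)
    image-recursion {f} f-alg zero = ≋-sym (⋆-cong []-homo (≋-refl {(𝟏ˢ ⊕ t •ˢ image f) 0}))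
      where
      open IsAlgebraMap f-alg
    image-recursion {f} f-alg (suc m) =
      ≋-trans (cong (𝓑̂k≈conv m)) (≋-trans (conv-homo qH 1+t𝓑̂ (suc m)) (conv-congʳ (f ∘ qH) f∘1+t𝓑̂ (suc m)))
      where
      open IsAlgebraMap f-alg
      f∘1+t𝓑̂ : f ∘ 1+t𝓑̂ ≋ˢ 𝟏ˢ ⊕ t •ˢ image f
      f∘1+t𝓑̂ zero = ≋-trans 1-homo (≋-sym (++-identityʳ 1T))
      f∘1+t𝓑̂ (suc n) = •-homo t (𝓑̂k q t (suc n))

    H⊗1 1⊗H H₊⊗1 : ℕ → T
    H⊗1 i = Hk i ⊗ 1N
    1⊗H j = 1N ⊗ Hk j
    H₊⊗1 zero = []
    H₊⊗1 (suc i) = H⊗1 (suc i)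

    H⊗1⋆1⊗H : ∀ i j → H⊗1 i *T 1⊗H j ≈ₜ Hk i ⊗ Hk j
    H⊗1⋆1⊗H i j = ≋-trans (⊗-⋆ (Hk i) 1N 1N (Hk j)) (⊗-cong (Nsym.⋆-identityʳ (Hk i)) (Nsym.⋆-identityˡ (Hk j)))

    1⊗H⋆H⊗1 : ∀ i j → 1⊗H j *T H⊗1 i ≈ₜ Hk i ⊗ Hk j
    1⊗H⋆H⊗1 i j = ≋-trans (⊗-⋆ 1N (Hk j) (Hk i) 1N) (⊗-cong (Nsym.⋆-identityˡ (Hk i)) (Nsym.⋆-identityʳ (Hk j)))

    △Hk≈conv : ∀ s → △Hk s ≈ₜ conv 1⊗H H⊗1 s
    △Hk≈conv s = ≋-sym (≋-trans
      (conv-comm 1⊗H H⊗1 (λ i j → ≋-trans (1⊗H⋆H⊗1 j i) (≋-sym (H⊗1⋆1⊗H j i))) s)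
      (≋-trans (conv≋∑ᴱ H⊗1 1⊗H s) (∑ᴱ-cong (λ i → H⊗1⋆1⊗H i (s ∸ i)) (upTo (suc s)))))

    H⊗1≈𝟏⊕H₊⊗1 : H⊗1 ≋ˢ 𝟏ˢ ⊕ H₊⊗1
    H⊗1≈𝟏⊕H₊⊗1 zero = ≋-trans (⊗-cong H0≈1 (Nsym.≋-refl {1N})) (≋-trans 1⊗1≈1 (≋-sym (++-identityʳ 1T)))
    H⊗1≈𝟏⊕H₊⊗1 (suc i) = ≋-refl

    conv-1⊗H-H⊗1-suc : ∀ n → conv 1⊗H H⊗1 (suc n) ≈ₜ H⊗1 (suc n) ++ (1⊗H (suc n) ++ conv (shift 1⊗H) H₊⊗1 n)
    conv-1⊗H-H⊗1-suc n = ++-cong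
      (≋-trans (⋆-cong 1⊗H0≈1 (≋-refl {H⊗1 (suc n)})) (⋆-identityˡ (H⊗1 (suc n))))
      (≋-trans (conv-congʳ (shift 1⊗H) H⊗1≈𝟏⊕H₊⊗1 n)
      (≋-trans (conv-⊕ʳ (shift 1⊗H) 𝟏ˢ H₊⊗1 n) (++-cong (conv-𝟏ʳ (shift 1⊗H) n) ≋-refl)))
      where
      1⊗H0≈1 : 1⊗H 0 ≈ₜ 1T
      1⊗H0≈1 = ≋-trans (⊗-cong (Nsym.≋-refl {1N}) H0≈1) 1⊗1≈1

    △qH-suc : ∀ n → △ (qH (suc n)) ≈ₜ pow q n ·T conv 1⊗H H⊗1 (suc n)
    △qH-suc n = ≋-trans (△-• (pow q n) (Hk (suc n)))
      (•-congˡ _ (≋-trans (△-H (suc n ∷ [])) (≋-trans (⋆-identityʳ (△Hk (suc n))) (△Hk≈conv (suc n)))))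

    qH⊗1-suc : ∀ n → embedˡ (qH (suc n)) ≈ₜ pow q n ·T H⊗1 (suc n)
    qH⊗1-suc n = ⊗-•ˡ (pow q n) (Hk (suc n)) 1N

    1⊗qH-suc : ∀ n → embedʳ (qH (suc n)) ≈ₜ pow q n ·T 1⊗H (suc n)
    1⊗qH-suc n = ⊗-•ʳ (pow q n) 1N (Hk (suc n))

    conv-1⊗qH-qH⊗1-shifted : ∀ r m →
      q ·T conv (λ k → embedʳ (qH (suc r ℕ.+ k))) (embedˡ ∘ qH) m ≈ₜ pow q (r ℕ.+ m) ·T conv (λ k → 1⊗H (suc r ℕ.+ k)) H₊⊗1 m
    conv-1⊗qH-qH⊗1-shifted r zero = ≋-trans (•-congˡ q (⋆-zeroʳ (embedʳ (qH (suc r ℕ.+ 0)))))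
      (≋-sym (•-congˡ (pow q (r ℕ.+ 0)) (⋆-zeroʳ (1⊗H (suc r ℕ.+ 0)))))
    conv-1⊗qH-qH⊗1-shifted r (suc m) =
      ≋-trans (•-++ q (embedʳ (qH (suc r ℕ.+ 0)) *T embedˡ (qH (suc m))) (conv (λ k → embedʳ (qH (suc r ℕ.+ suc k))) (embedˡ ∘ qH) m))
      (≋-trans (++-cong first rest)
        (≋-sym (•-++ (pow q (r ℕ.+ suc m)) (1⊗H (suc r ℕ.+ 0) *T H₊⊗1 (suc m)) (conv (λ k → 1⊗H (suc r ℕ.+ suc k)) H₊⊗1 m))))
      where
      open ≋-Reasoning
      first : q ·T (embedʳ (qH (suc r ℕ.+ 0)) *T embedˡ (qH (suc m))) ≈ₜ pow q (r ℕ.+ suc m) ·T (1⊗H (suc r ℕ.+ 0) *T H₊⊗1 (suc m))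
      first = begin
        q ·T (embedʳ (qH (suc r ℕ.+ 0)) *T embedˡ (qH (suc m)))
          ≈⟨ •-congˡ q (⋆-cong (≋-trans (≡⇒≋ (P.cong (embedʳ ∘ qH) (P.cong suc (ℕP.+-identityʳ r)))) (1⊗qH-suc r)) (qH⊗1-suc m)) ⟩
        q ·T ((pow q r ·T 1⊗H (suc r)) *T (pow q m ·T H⊗1 (suc m)))
          ≈⟨ •-congˡ q (≋-trans (⋆-•ˡ (pow q r) (1⊗H (suc r)) (pow q m ·T H⊗1 (suc m)))
                       (≋-trans (•-congˡ (pow q r) (⋆-•ʳ (pow q m) (1⊗H (suc r)) (H⊗1 (suc m))))
                                (•-assoc (pow q r) (pow q m) (1⊗H (suc r) *T H⊗1 (suc m))))) ⟩
        q ·T ((pow q r * pow q m) ·T (1⊗H (suc r) *T H⊗1 (suc m)))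
          ≈⟨ •-assoc q (pow q r * pow q m) (1⊗H (suc r) *T H⊗1 (suc m)) ⟩
        (q * (pow q r * pow q m)) ·T (1⊗H (suc r) *T H⊗1 (suc m))
          ≈⟨ •-cong (trans (solve 3 (λ q a b → q :* (a :* b) := a :* (q :* b)) refl q (pow q r) (pow q m)) (sym (pow-+ q r (suc m))))
                    (⋆-cong (≡⇒≋ (P.cong 1⊗H (P.cong suc (P.sym (ℕP.+-identityʳ r))))) (≋-refl {H⊗1 (suc m)})) ⟩
        pow q (r ℕ.+ suc m) ·T (1⊗H (suc r ℕ.+ 0) *T H₊⊗1 (suc m)) ∎
      rest : q ·T conv (λ k → embedʳ (qH (suc r ℕ.+ suc k))) (embedˡ ∘ qH) m
               ≈ₜ pow q (r ℕ.+ suc m) ·T conv (λ k → 1⊗H (suc r ℕ.+ suc k)) H₊⊗1 m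
      rest = ≋-trans (•-congˡ q (conv-congˡ (embedˡ ∘ qH) (λ k → ≡⇒≋ (P.cong (embedʳ ∘ qH) (P.cong suc (ℕP.+-suc r k)))) m))
        (≋-trans (conv-1⊗qH-qH⊗1-shifted (suc r) m)
          (•-cong (reflexive (P.cong (pow q) (P.sym (ℕP.+-suc r m))))
                  (conv-congˡ H₊⊗1 (λ k → ≡⇒≋ (P.cong 1⊗H (P.cong suc (P.sym (ℕP.+-suc r k))))) m)))

    -- △(qⁿ Hₙ₊₁) = Σᵢ₊ⱼ₌ₙ₊₁ qⁿ Hᵢ ⊗ Hⱼ: the terms with i = 0 or j = 0, and q times the mixed products.
    △qH-decomposition : △ ∘ qH ≋ˢ embedˡ ∘ qH ⊕ embedʳ ∘ qH ⊕ q •ˢ conv (embedʳ ∘ qH) (embedˡ ∘ qH)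
    △qH-decomposition zero = mk≋ λ w → refl
    △qH-decomposition (suc n) = begin
      △ (qH (suc n))
        ≈⟨ △qH-suc n ⟩
      pow q n ·T conv 1⊗H H⊗1 (suc n)
        ≈⟨ •-congˡ _ (conv-1⊗H-H⊗1-suc n) ⟩
      pow q n ·T (H⊗1 (suc n) ++ (1⊗H (suc n) ++ mixed))
        ≈⟨ ≋-trans (•-++ (pow q n) (H⊗1 (suc n)) _) (++-cong (≋-refl {pow q n ·T H⊗1 (suc n)}) (•-++ (pow q n) (1⊗H (suc n)) mixed)) ⟩
      pow q n ·T H⊗1 (suc n) ++ (pow q n ·T 1⊗H (suc n) ++ pow q n ·T mixed)
        ≈⟨ ++-cong (≋-sym (qH⊗1-suc n)) (++-cong (≋-sym (1⊗qH-suc n)) (≋-sym (conv-1⊗qH-qH⊗1-shifted 0 n))) ⟩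
      embedˡ (qH (suc n)) ++ (embedʳ (qH (suc n)) ++ q ·T conv (embedʳ ∘ qH) (embedˡ ∘ qH) (suc n))
        ≈⟨ ≋-sym (++-assoc (embedˡ (qH (suc n))) (embedʳ (qH (suc n))) _) ⟩
      (embedˡ (qH (suc n)) ++ embedʳ (qH (suc n))) ++ q ·T conv (embedʳ ∘ qH) (embedˡ ∘ qH) (suc n) ∎
      where
      open ≋-Reasoning
      mixed : T
      mixed = conv (shift 1⊗H) H₊⊗1 n

    𝓑̂⊗1 1⊗𝓑̂ △𝓑̂ : ℕ → T
    𝓑̂⊗1 = image embedˡ
    1⊗𝓑̂ = image embedʳ
    △𝓑̂ = image △

    rhsTerm : List Bool → T
    rhsTerm A = (pow (q + t) (length (c₂ A)) * pow t (length (c₁ A))) ·T (𝓑̂ q t (αA A) ⊗ 𝓑̂ q t (βA A))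

    weighted : ℕ → ℕ → Comp → Comp → T
    weighted n₂ n₁ α β = (pow (q + t) n₂ * pow t n₁) ·T (𝓑̂ q t α ⊗ 𝓑̂ q t β)

    weighted-≡ : ∀ {n₂ n₂' n₁ n₁' α α' β β'} → n₂ ≡ n₂' → n₁ ≡ n₁' → α ≡ α' → β ≡ β' →
                 weighted n₂ n₁ α β ≡ weighted n₂' n₁' α' β'
    weighted-≡ P.refl P.refl P.refl P.refl = P.refl

    rhsTerm≡weighted : ∀ A → rhsTerm A ≡ weighted (interiorRunEnds (map not A)) (interiorRunEnds A) (runLengths A) (runLengths (map not A))
    rhsTerm≡weighted A = weighted-≡ (length-c₁ (map not A)) (length-c₁ A) (αA≡runLengths A) (βA≡runLengths A)

    weighted-left : ∀ n₂ n₁ r α β → weighted n₂ (suc n₁) (suc r ∷ α) β ≈ₜ t ·T (𝓑̂⊗1 (suc r) *T weighted n₂ n₁ α β)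
    weighted-left n₂ n₁ r α β =
      ≋-trans (•-congˡ _ (⊗-cong (Nsym.≋-sym (𝓑̂-⋆ (suc r ∷ []) α)) (Nsym.≋-sym (Nsym.⋆-identityˡ (𝓑̂ q t β)))))
      (≋-trans (•-congˡ _ (≋-sym (⊗-⋆ (𝓑̂k q t (suc r)) 1N (𝓑̂ q t α) (𝓑̂ q t β))))
      (≋-trans (•-cong (solve 3 (λ κ t p → κ :* (t :* p) := t :* (κ :* p)) refl _ t _) ≋-refl)
      (≋-trans (≋-sym (•-assoc t _ _)) (•-congˡ t (≋-sym (⋆-•ʳ _ (𝓑̂⊗1 (suc r)) (𝓑̂ q t α ⊗ 𝓑̂ q t β)))))))

    weighted-right : ∀ n₂ n₁ r α β → weighted (suc n₂) n₁ α (suc r ∷ β) ≈ₜ (q + t) ·T (1⊗𝓑̂ (suc r) *T weighted n₂ n₁ α β)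
    weighted-right n₂ n₁ r α β =
      ≋-trans (•-congˡ _ (⊗-cong (Nsym.≋-sym (Nsym.⋆-identityˡ (𝓑̂ q t α))) (Nsym.≋-sym (𝓑̂-⋆ (suc r ∷ []) β))))
      (≋-trans (•-congˡ _ (≋-sym (⊗-⋆ 1N (𝓑̂k q t (suc r)) (𝓑̂ q t α) (𝓑̂ q t β))))
      (≋-trans (•-cong (*-assoc _ _ _) ≋-refl)
      (≋-trans (≋-sym (•-assoc (q + t) _ _)) (•-congˡ (q + t) (≋-sym (⋆-•ʳ _ (1⊗𝓑̂ (suc r)) (𝓑̂ q t α ⊗ 𝓑̂ q t β)))))))

    weighted-0-0 : ∀ α β → weighted 0 0 α β ≈ₜ 𝓑̂ q t α ⊗ 𝓑̂ q t β
    weighted-0-0 α β = ≋-trans (•-cong (*-identityˡ _) ≋-refl) (•-identity _)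

    rhsTerm-trues-false : ∀ r bs → rhsTerm (replicate (suc r) true ++ false ∷ bs) ≈ₜ t ·T (𝓑̂⊗1 (suc r) *T rhsTerm (false ∷ bs))
    rhsTerm-trues-false r bs =
      ≋-trans (≡⇒≋ (P.trans (rhsTerm≡weighted A) (weighted-≡ n₂≡ (interiorRunEnds-trues-false r bs) (runLengths-trues-false r bs) β≡)))
      (≋-trans (weighted-left (interiorRunEnds (true ∷ map not bs)) (interiorRunEnds bs) r (runLengths bs) (runLengths (true ∷ map not bs)))
        (•-congˡ t (⋆-cong (≋-refl {𝓑̂⊗1 (suc r)}) (≡⇒≋ (P.sym (rhsTerm≡weighted (false ∷ bs)))))))
      where
      A : List Bool
      A = replicate (suc r) true ++ false ∷ bs
      ¬A≡ : map not A ≡ replicate (suc r) false ++ true ∷ map not bs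
      ¬A≡ = map-not-replicate-++ (suc r) true (false ∷ bs)
      n₂≡ : interiorRunEnds (map not A) ≡ interiorRunEnds (true ∷ map not bs)
      n₂≡ = P.trans (P.cong interiorRunEnds ¬A≡) (interiorRunEnds-falses (suc r) _)
      β≡ : runLengths (map not A) ≡ runLengths (true ∷ map not bs)
      β≡ = P.trans (P.cong runLengths ¬A≡) (runLengths-falses (suc r) _)

    rhsTerm-falses-true : ∀ r bs → rhsTerm (replicate (suc r) false ++ true ∷ bs) ≈ₜ (q + t) ·T (1⊗𝓑̂ (suc r) *T rhsTerm (true ∷ bs))
    rhsTerm-falses-true r bs =
      ≋-trans (≡⇒≋ (P.trans (rhsTerm≡weighted A)
                    (weighted-≡ n₂≡ (interiorRunEnds-falses (suc r) (true ∷ bs)) (runLengths-falses (suc r) (true ∷ bs)) β≡)))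
      (≋-trans (weighted-right (interiorRunEnds (map not bs)) (interiorRunEnds (true ∷ bs)) r (runLengths (true ∷ bs)) (runLengths (map not bs)))
        (•-congˡ (q + t) (⋆-cong (≋-refl {1⊗𝓑̂ (suc r)}) (≡⇒≋ (P.sym (rhsTerm≡weighted (true ∷ bs)))))))
      where
      A : List Bool
      A = replicate (suc r) false ++ true ∷ bs
      ¬A≡ : map not A ≡ replicate (suc r) true ++ false ∷ map not bs
      ¬A≡ = map-not-replicate-++ (suc r) false (true ∷ bs)
      n₂≡ : interiorRunEnds (map not A) ≡ suc (interiorRunEnds (map not bs))
      n₂≡ = P.trans (P.cong interiorRunEnds ¬A≡) (interiorRunEnds-trues-false r _)
      β≡ : runLengths (map not A) ≡ suc r ∷ runLengths (map not bs)
      β≡ = P.trans (P.cong runLengths ¬A≡) (runLengths-trues-false r _)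

    rhsTerm-trues : ∀ r → rhsTerm (replicate (suc r) true ++ []) ≈ₜ 𝓑̂⊗1 (suc r)
    rhsTerm-trues r =
      ≋-trans (≡⇒≋ (P.trans (rhsTerm≡weighted A) (weighted-≡ n₂≡ n₁≡ α≡ β≡))) (weighted-0-0 (suc r ∷ []) [])
      where
      A : List Bool
      A = replicate (suc r) true ++ []
      ¬A≡ : map not A ≡ replicate (suc r) false ++ []
      ¬A≡ = map-not-replicate-++ (suc r) true []
      n₂≡ : interiorRunEnds (map not A) ≡ 0
      n₂≡ = P.trans (P.cong interiorRunEnds ¬A≡) (interiorRunEnds-falses (suc r) [])
      n₁≡ : interiorRunEnds A ≡ 0
      n₁≡ = P.trans (P.cong interiorRunEnds (LP.++-identityʳ (replicate (suc r) true))) (interiorRunEnds-trues r)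
      α≡ : runLengths A ≡ suc r ∷ []
      α≡ = P.trans (P.cong runLengths (LP.++-identityʳ (replicate (suc r) true))) (runLengths-trues r)
      β≡ : runLengths (map not A) ≡ []
      β≡ = P.trans (P.cong runLengths ¬A≡) (runLengths-falses (suc r) [])

    rhsTerm-falses : ∀ r → rhsTerm (replicate (suc r) false ++ []) ≈ₜ 1⊗𝓑̂ (suc r)
    rhsTerm-falses r =
      ≋-trans (≡⇒≋ (P.trans (rhsTerm≡weighted A) (weighted-≡ n₂≡ (interiorRunEnds-falses (suc r) []) (runLengths-falses (suc r) []) β≡)))
              (weighted-0-0 [] (suc r ∷ []))
      where
      A : List Bool
      A = replicate (suc r) false ++ []
      ¬A≡ : map not A ≡ replicate (suc r) true
      ¬A≡ = P.trans (map-not-replicate-++ (suc r) false []) (LP.++-identityʳ (replicate (suc r) true))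
      n₂≡ : interiorRunEnds (map not A) ≡ 0
      n₂≡ = P.trans (P.cong interiorRunEnds ¬A≡) (interiorRunEnds-trues r)
      β≡ : runLengths (map not A) ≡ suc r ∷ []
      β≡ = P.trans (P.cong runLengths ¬A≡) (runLengths-trues r)

    ∑ᴱ-allBits-suc : ∀ (G : List Bool → T) m → ΣT (map G (allBits (suc m))) ≈ₜ ΣT (map (λ bs → G (false ∷ bs) ++ G (true ∷ bs)) (allBits m))
    ∑ᴱ-allBits-suc G m = mk≋ λ w → trans (coeffAt-∑ᴱ-map G (allBits (suc m)) w) (trans (∑-allBits-suc m)
      (trans (∑-cong (λ bs → sym (coeffAt-++ (G (false ∷ bs)) (G (true ∷ bs)) w)) (allBits m))
             (sym (coeffAt-∑ᴱ-map (λ bs → G (false ∷ bs) ++ G (true ∷ bs)) (allBits m) w))))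

    ∑ᴱ-•-⋆ : ∀ {a} {A : Set a} (κ : K) (E : T) (F : A → T) xs → ΣT (map (λ x → κ ·T (E *T F x)) xs) ≈ₜ E *T (κ ·T ΣT (map F xs))
    ∑ᴱ-•-⋆ κ E F xs = ≋-trans (≡⇒≋ (P.cong ΣT (LP.map-∘ xs)))
      (≋-trans (≋-sym (•-∑ᴱ κ (map (λ x → E *T F x) xs)))
      (≋-trans (•-congˡ κ (≋-trans (≡⇒≋ (P.cong ΣT (LP.map-∘ xs))) (≋-sym (⋆-∑ᴱ E (map F xs)))))
                      (≋-sym (⋆-•ʳ κ E (ΣT (map F xs))))))

    rhs∋1 rhs∌1 : ℕ → T
    rhs∋1 zero = []
    rhs∋1 (suc m) = ΣT (map (λ A → rhsTerm (true ∷ A)) (allBits m))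
    rhs∌1 zero = []
    rhs∌1 (suc m) = ΣT (map (λ A → rhsTerm (false ∷ A)) (allBits m))

    rhs-split : ∀ m → coprodRHS q t (suc m) ≈ₜ rhs∋1 (suc m) ++ rhs∌1 (suc m)
    rhs-split m = ≋-trans (∑ᴱ-allBits-suc rhsTerm m)
      (≋-trans (∑ᴱ-map-++ (λ bs → rhsTerm (false ∷ bs)) (λ bs → rhsTerm (true ∷ bs)) (allBits m))
                      (++-comm (rhs∌1 (suc m)) (rhs∋1 (suc m))))

    rhs-0 : coprodRHS q t 0 ≈ₜ 1T
    rhs-0 = ≋-trans (++-identityʳ _) (≋-trans (weighted-0-0 [] []) 1⊗1≈1)

    afterIn afterOut : ℕ → T
    afterIn = 𝟏ˢ ⊕ t •ˢ rhs∌1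
    afterOut = 𝟏ˢ ⊕ (q + t) •ˢ rhs∋1

    -- Peeling off the first run of A (of trues or of falses) turns the sum into a convolution.
    rhs-trues-prefix : ∀ r m → ΣT (map (λ A → rhsTerm (replicate (suc r) true ++ A)) (allBits m)) ≈ₜ conv (λ k → 𝓑̂⊗1 (suc r ℕ.+ k)) afterIn m
    rhs-trues-prefix r zero = ≋-trans (++-identityʳ _) (≋-trans (rhsTerm-trues r) (≋-sym
      (≋-trans (⋆-cong (≡⇒≋ (P.cong 𝓑̂⊗1 (P.cong suc (ℕP.+-identityʳ r)))) (++-identityʳ 1T)) (⋆-identityʳ (𝓑̂⊗1 (suc r))))))
    rhs-trues-prefix r (suc m) = ≋-trans (∑ᴱ-allBits-suc G m)
      (≋-trans (∑ᴱ-map-++ (λ bs → G (false ∷ bs)) (λ bs → G (true ∷ bs)) (allBits m)) (++-cong first rest))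
      where
      G : List Bool → T
      G A = rhsTerm (replicate (suc r) true ++ A)
      first : ΣT (map (λ bs → G (false ∷ bs)) (allBits m)) ≈ₜ 𝓑̂⊗1 (suc r ℕ.+ 0) *T afterIn (suc m)
      first = ≋-trans (∑ᴱ-cong (rhsTerm-trues-false r) (allBits m))
        (≋-trans (∑ᴱ-•-⋆ t (𝓑̂⊗1 (suc r)) (λ bs → rhsTerm (false ∷ bs)) (allBits m))
                        (⋆-cong (≡⇒≋ (P.cong 𝓑̂⊗1 (P.cong suc (P.sym (ℕP.+-identityʳ r))))) (≋-refl {t ·T rhs∌1 (suc m)})))
      rest : ΣT (map (λ bs → G (true ∷ bs)) (allBits m)) ≈ₜ conv (λ k → 𝓑̂⊗1 (suc r ℕ.+ suc k)) afterIn m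
      rest = ≋-trans (≡⇒≋ (P.cong ΣT (LP.map-cong (λ bs → P.cong rhsTerm (P.sym (replicate-suc-++ (suc r) true bs))) (allBits m))))
        (≋-trans (rhs-trues-prefix (suc r) m) (conv-congˡ afterIn (λ k → ≡⇒≋ (P.cong 𝓑̂⊗1 (P.cong suc (P.sym (ℕP.+-suc r k))))) m))

    rhs-falses-prefix : ∀ r m → ΣT (map (λ A → rhsTerm (replicate (suc r) false ++ A)) (allBits m)) ≈ₜ conv (λ k → 1⊗𝓑̂ (suc r ℕ.+ k)) afterOut m
    rhs-falses-prefix r zero = ≋-trans (++-identityʳ _) (≋-trans (rhsTerm-falses r) (≋-sym
      (≋-trans (⋆-cong (≡⇒≋ (P.cong 1⊗𝓑̂ (P.cong suc (ℕP.+-identityʳ r)))) (++-identityʳ 1T)) (⋆-identityʳ (1⊗𝓑̂ (suc r))))))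
    rhs-falses-prefix r (suc m) = ≋-trans (∑ᴱ-allBits-suc G m)
      (≋-trans (∑ᴱ-map-++ (λ bs → G (false ∷ bs)) (λ bs → G (true ∷ bs)) (allBits m))
      (≋-trans (++-comm (ΣT (map (λ bs → G (false ∷ bs)) (allBits m))) (ΣT (map (λ bs → G (true ∷ bs)) (allBits m))))
                      (++-cong first rest)))
      where
      G : List Bool → T
      G A = rhsTerm (replicate (suc r) false ++ A)
      first : ΣT (map (λ bs → G (true ∷ bs)) (allBits m)) ≈ₜ 1⊗𝓑̂ (suc r ℕ.+ 0) *T afterOut (suc m)
      first = ≋-trans (∑ᴱ-cong (rhsTerm-falses-true r) (allBits m))
        (≋-trans (∑ᴱ-•-⋆ (q + t) (1⊗𝓑̂ (suc r)) (λ bs → rhsTerm (true ∷ bs)) (allBits m))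
                        (⋆-cong (≡⇒≋ (P.cong 1⊗𝓑̂ (P.cong suc (P.sym (ℕP.+-identityʳ r))))) (≋-refl {(q + t) ·T rhs∋1 (suc m)})))
      rest : ΣT (map (λ bs → G (false ∷ bs)) (allBits m)) ≈ₜ conv (λ k → 1⊗𝓑̂ (suc r ℕ.+ suc k)) afterOut m
      rest = ≋-trans (≡⇒≋ (P.cong ΣT (LP.map-cong (λ bs → P.cong rhsTerm (P.sym (replicate-suc-++ (suc r) false bs))) (allBits m))))
        (≋-trans (rhs-falses-prefix (suc r) m) (conv-congˡ afterOut (λ k → ≡⇒≋ (P.cong 1⊗𝓑̂ (P.cong suc (P.sym (ℕP.+-suc r k))))) m))

    rhs∋1≈conv : rhs∋1 ≋ˢ conv 𝓑̂⊗1 afterIn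
    rhs∋1≈conv zero = ≋-refl
    rhs∋1≈conv (suc m) = rhs-trues-prefix 0 m

    rhs∌1≈conv : rhs∌1 ≋ˢ conv 1⊗𝓑̂ afterOut
    rhs∌1≈conv zero = ≋-refl
    rhs∌1≈conv (suc m) = rhs-falses-prefix 0 m

    rhs : ℕ → T
    rhs = rhs∋1 ⊕ rhs∌1

    rhs∋1≈conv-qH⊗1 : rhs∋1 ≋ˢ conv (embedˡ ∘ qH) (𝟏ˢ ⊕ t •ˢ rhs)
    rhs∋1≈conv-qH⊗1 n = begin
      rhs∋1 n                                                      ≈⟨ rhs∋1≈conv n ⟩
      conv 𝓑̂⊗1 afterIn n                                           ≈⟨ conv-congˡ afterIn (image-recursion embedˡ-isAlgebraMap) n ⟩
      conv (conv (embedˡ ∘ qH) (𝟏ˢ ⊕ t •ˢ 𝓑̂⊗1)) afterIn n           ≈⟨ conv-assoc (embedˡ ∘ qH) (𝟏ˢ ⊕ t •ˢ 𝓑̂⊗1) afterIn n ⟩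
      conv (embedˡ ∘ qH) (conv (𝟏ˢ ⊕ t •ˢ 𝓑̂⊗1) afterIn) n           ≈⟨ conv-congʳ (embedˡ ∘ qH) inner n ⟩
      conv (embedˡ ∘ qH) (𝟏ˢ ⊕ t •ˢ rhs) n                          ∎
      where
      open ≋-Reasoning
      inner : conv (𝟏ˢ ⊕ t •ˢ 𝓑̂⊗1) afterIn ≋ˢ 𝟏ˢ ⊕ t •ˢ rhs
      inner k = begin
        conv (𝟏ˢ ⊕ t •ˢ 𝓑̂⊗1) afterIn k                  ≈⟨ conv-⊕ˡ 𝟏ˢ (t •ˢ 𝓑̂⊗1) afterIn k ⟩
        conv 𝟏ˢ afterIn k ++ conv (t •ˢ 𝓑̂⊗1) afterIn k
          ≈⟨ ++-cong (conv-𝟏ˡ afterIn k) (≋-trans (conv-•ˡ t 𝓑̂⊗1 afterIn k) (•-congˡ t (≋-sym (rhs∋1≈conv k)))) ⟩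
        (𝟏ˢ k ++ t ·T rhs∌1 k) ++ t ·T rhs∋1 k           ≈⟨ ++-•-regroup t (𝟏ˢ k) (rhs∋1 k) (rhs∌1 k) ⟩
        𝟏ˢ k ++ t ·T rhs k                               ∎

    rhs∌1≈conv-1⊗qH : rhs∌1 ≋ˢ conv (embedʳ ∘ qH) (afterOut ⊕ t •ˢ rhs∌1)
    rhs∌1≈conv-1⊗qH n = begin
      rhs∌1 n                                                ≈⟨ rhs∌1≈conv n ⟩
      conv 1⊗𝓑̂ afterOut n                                    ≈⟨ conv-congˡ afterOut (image-recursion embedʳ-isAlgebraMap) n ⟩
      conv (conv (embedʳ ∘ qH) (𝟏ˢ ⊕ t •ˢ 1⊗𝓑̂)) afterOut n    ≈⟨ conv-assoc (embedʳ ∘ qH) (𝟏ˢ ⊕ t •ˢ 1⊗𝓑̂) afterOut n ⟩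
      conv (embedʳ ∘ qH) (conv (𝟏ˢ ⊕ t •ˢ 1⊗𝓑̂) afterOut) n    ≈⟨ conv-congʳ (embedʳ ∘ qH) inner n ⟩
      conv (embedʳ ∘ qH) (afterOut ⊕ t •ˢ rhs∌1) n            ∎
      where
      open ≋-Reasoning
      inner : conv (𝟏ˢ ⊕ t •ˢ 1⊗𝓑̂) afterOut ≋ˢ afterOut ⊕ t •ˢ rhs∌1
      inner k = ≋-trans (conv-⊕ˡ 𝟏ˢ (t •ˢ 1⊗𝓑̂) afterOut k)
        (++-cong (conv-𝟏ˡ afterOut k) (≋-trans (conv-•ˡ t 1⊗𝓑̂ afterOut k) (•-congˡ t (≋-sym (rhs∌1≈conv k)))))

    rhs-recursion : rhs ≋ˢ conv (△ ∘ qH) (𝟏ˢ ⊕ t •ˢ rhs)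
    rhs-recursion n = ≋-sym (begin
      conv (△ ∘ qH) W n
        ≈⟨ conv-congˡ W △qH-decomposition n ⟩
      conv (P⊗1 ⊕ 1⊗P ⊕ q •ˢ conv 1⊗P P⊗1) W n
        ≈⟨ conv-⊕ˡ (P⊗1 ⊕ 1⊗P) (q •ˢ conv 1⊗P P⊗1) W n ⟩
      conv (P⊗1 ⊕ 1⊗P) W n ++ conv (q •ˢ conv 1⊗P P⊗1) W n
        ≈⟨ ++-cong (conv-⊕ˡ P⊗1 1⊗P W n) (≋-trans (conv-•ˡ q (conv 1⊗P P⊗1) W n) (•-congˡ q (conv-assoc 1⊗P P⊗1 W n))) ⟩
      (conv P⊗1 W n ++ conv 1⊗P W n) ++ q ·T conv 1⊗P (conv P⊗1 W) n
        ≈⟨ ++-cong (++-cong (≋-sym (rhs∋1≈conv-qH⊗1 n)) ≋-refl) (•-congˡ q (conv-congʳ 1⊗P (≋ˢ-sym rhs∋1≈conv-qH⊗1) n)) ⟩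
      (rhs∋1 n ++ conv 1⊗P W n) ++ q ·T conv 1⊗P rhs∋1 n
        ≈⟨ ++-assoc (rhs∋1 n) (conv 1⊗P W n) _ ⟩
      rhs∋1 n ++ (conv 1⊗P W n ++ q ·T conv 1⊗P rhs∋1 n)
        ≈⟨ ++-cong ≋-refl (≋-trans (++-cong ≋-refl (≋-sym (conv-•ʳ q 1⊗P rhs∋1 n))) (≋-sym (conv-⊕ʳ 1⊗P W (q •ˢ rhs∋1) n))) ⟩
      rhs∋1 n ++ conv 1⊗P (W ⊕ q •ˢ rhs∋1) n
        ≈⟨ ++-cong ≋-refl (conv-congʳ 1⊗P (λ k → ++-•-regroup₂ t q (𝟏ˢ k) (rhs∋1 k) (rhs∌1 k)) n) ⟩
      rhs∋1 n ++ conv 1⊗P (afterOut ⊕ t •ˢ rhs∌1) n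
        ≈⟨ ++-cong ≋-refl (≋-sym (rhs∌1≈conv-1⊗qH n)) ⟩
      rhs n ∎)
      where
      open ≋-Reasoning
      W P⊗1 1⊗P : ℕ → T
      W = 𝟏ˢ ⊕ t •ˢ rhs
      P⊗1 = embedˡ ∘ qH
      1⊗P = embedʳ ∘ qH

    -- △(qH 0) = 0, so the degree-(k+1) part of a solution depends only on its parts of degree ≤ k.
    recursion-unique : ∀ Y Z → Y ≋ˢ conv (△ ∘ qH) (𝟏ˢ ⊕ t •ˢ Y) → Z ≋ˢ conv (△ ∘ qH) (𝟏ˢ ⊕ t •ˢ Z) → Y ≋ˢ Z
    recursion-unique Y Z Y-rec Z-rec k = upTo-k k k ℕP.≤-refl
      where
      upTo-k : ∀ k j → j ≤ k → Y j ≈ₜ Z j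
      upTo-k zero .0 z≤n = ≋-trans (Y-rec 0) (≋-sym (Z-rec 0))
      upTo-k (suc k) j j≤1+k with ℕP.m≤n⇒m<n∨m≡n j≤1+k
      ... | inj₁ j<1+k = upTo-k k j (ℕP.≤-pred j<1+k)
      ... | inj₂ P.refl = ≋-trans (Y-rec (suc k))
        (≋-trans (conv-congʳ-upTo (shift (△ ∘ qH)) k (λ j j≤k → ++-cong (≋-refl {𝟏ˢ j}) (•-congˡ t (upTo-k k j j≤k))))
                        (≋-sym (Z-rec (suc k))))

    △𝓑̂≈rhs : △𝓑̂ ≋ˢ rhs
    △𝓑̂≈rhs = recursion-unique △𝓑̂ rhs (image-recursion △-isAlgebraMap) rhs-recursion

    △𝓑̂k-formula : ∀ k → △ (𝓑̂k q t k) ≈T coprodRHS q t k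
    △𝓑̂k-formula zero = ≈ₜ⇒≈T (≋-trans △-1 (≋-sym rhs-0))
    △𝓑̂k-formula (suc m) = ≈ₜ⇒≈T (≋-trans (△𝓑̂≈rhs (suc m)) (≋-sym (rhs-split m)))

    -- With q + t = 0 only the initial segments A = [i] survive, and with t = 1 each has weight 1.
    △𝓑̂k≈∑𝓑̂⊗𝓑̂ : q + t ≈ 0# → t ≈ 1# →
                 ∀ k → △ (𝓑̂k q t k) ≈ₜ ΣT (map (λ i → 𝓑̂k q t i ⊗ 𝓑̂k q t (k ∸ i)) (upTo (suc k)))
    △𝓑̂k≈∑𝓑̂⊗𝓑̂ q+t≈0 t≈1 zero = ≋-trans △-1 (≋-sym (≋-trans (++-identityʳ _) 1⊗1≈1))
    △𝓑̂k≈∑𝓑̂⊗𝓑̂ q+t≈0 t≈1 (suc m) = begin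
      △ (𝓑̂k q t (suc m))
        ≈⟨ ≋-trans (△𝓑̂≈rhs (suc m)) (++-comm (rhs∋1 (suc m)) (rhs∌1 (suc m))) ⟩
      rhs∌1 (suc m) ++ rhs∋1 (suc m)
        ≈⟨ ++-cong (rhs∌1≈1⊗𝓑̂ (suc m)) (≋-trans (rhs∋1≈conv (suc m)) (conv-congʳ 𝓑̂⊗1 afterIn≈ (suc m))) ⟩
      1⊗𝓑̂ (suc m) ++ conv 𝓑̂⊗1 (𝟏ˢ ⊕ 1⊗𝓑̂) (suc m)
        ≈⟨ ≋-sym (++-cong (conv-𝟏ˡ (𝟏ˢ ⊕ 1⊗𝓑̂) (suc m)) ≋-refl) ⟩
      conv 𝟏ˢ (𝟏ˢ ⊕ 1⊗𝓑̂) (suc m) ++ conv 𝓑̂⊗1 (𝟏ˢ ⊕ 1⊗𝓑̂) (suc m)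
        ≈⟨ ≋-sym (conv-⊕ˡ 𝟏ˢ 𝓑̂⊗1 (𝟏ˢ ⊕ 1⊗𝓑̂) (suc m)) ⟩
      conv (𝟏ˢ ⊕ 𝓑̂⊗1) (𝟏ˢ ⊕ 1⊗𝓑̂) (suc m)
        ≈⟨ ≋-sym (conv-cong 𝓑̂k⊗1≈ 1⊗𝓑̂k≈ (suc m)) ⟩
      conv 𝓑̂k⊗1 1⊗𝓑̂k (suc m)
        ≈⟨ conv≋∑ᴱ 𝓑̂k⊗1 1⊗𝓑̂k (suc m) ⟩
      ΣT (map (λ i → 𝓑̂k⊗1 i *T 1⊗𝓑̂k (suc m ∸ i)) (upTo (suc (suc m))))
        ≈⟨ ∑ᴱ-cong (λ i → ⊗-as-⋆ i (suc m ∸ i)) (upTo (suc (suc m))) ⟩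
      ΣT (map (λ i → 𝓑̂k q t i ⊗ 𝓑̂k q t (suc m ∸ i)) (upTo (suc (suc m)))) ∎
      where
      open ≋-Reasoning
      𝓑̂k⊗1 1⊗𝓑̂k : ℕ → T
      𝓑̂k⊗1 i = embedˡ (𝓑̂k q t i)
      1⊗𝓑̂k j = embedʳ (𝓑̂k q t j)
      ⊗-as-⋆ : ∀ i j → 𝓑̂k⊗1 i *T 1⊗𝓑̂k j ≈ₜ 𝓑̂k q t i ⊗ 𝓑̂k q t j
      ⊗-as-⋆ i j = ≋-trans (⊗-⋆ (𝓑̂k q t i) 1N 1N (𝓑̂k q t j)) (⊗-cong (Nsym.⋆-identityʳ (𝓑̂k q t i)) (Nsym.⋆-identityˡ (𝓑̂k q t j)))
      𝓑̂k⊗1≈ : 𝓑̂k⊗1 ≋ˢ 𝟏ˢ ⊕ 𝓑̂⊗1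
      𝓑̂k⊗1≈ zero = ≋-trans 1⊗1≈1 (≋-sym (++-identityʳ 1T))
      𝓑̂k⊗1≈ (suc n) = ≋-refl
      1⊗𝓑̂k≈ : 1⊗𝓑̂k ≋ˢ 𝟏ˢ ⊕ 1⊗𝓑̂
      1⊗𝓑̂k≈ zero = ≋-trans 1⊗1≈1 (≋-sym (++-identityʳ 1T))
      1⊗𝓑̂k≈ (suc n) = ≋-refl
      afterOut≈𝟏 : afterOut ≋ˢ 𝟏ˢ
      afterOut≈𝟏 k = ≋-trans (++-cong (≋-refl {𝟏ˢ k}) (≋-trans (•-cong q+t≈0 ≋-refl) (•-zero (rhs∋1 k)))) (++-identityʳ (𝟏ˢ k))
      rhs∌1≈1⊗𝓑̂ : rhs∌1 ≋ˢ 1⊗𝓑̂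
      rhs∌1≈1⊗𝓑̂ n = ≋-trans (rhs∌1≈conv n) (≋-trans (conv-congʳ 1⊗𝓑̂ afterOut≈𝟏 n) (conv-𝟏ʳ 1⊗𝓑̂ n))
      afterIn≈ : afterIn ≋ˢ 𝟏ˢ ⊕ 1⊗𝓑̂
      afterIn≈ k = ++-cong (≋-refl {𝟏ˢ k}) (≋-trans (•-cong t≈1 (rhs∌1≈1⊗𝓑̂ k)) (•-identity (1⊗𝓑̂ k)))

  △Λk-formula : ∀ k → △ (Λk k) ≈T sumΛΛ k
  △Λk-formula k = ≈ₜ⇒≈T {△ (Λk k)} {sumΛΛ k} (Tensor.≋-trans (△-cong (Nsym.≋-sym (𝓑̂≈Λ k)))
    (Tensor.≋-trans (Coproduct.△𝓑̂k≈∑𝓑̂⊗𝓑̂ (- 1#) 1# (-‿inverseˡ 1#) refl k)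
                    (Tensor.∑ᴱ-cong (λ i → ⊗-cong (𝓑̂≈Λ i) (𝓑̂≈Λ (k ∸ i))) (upTo (suc k)))))
    where
    𝓑̂≈Λ : ∀ i → 𝓑̂k (- 1#) 1# i ≈ₙ Λk i
    𝓑̂≈Λ i = ≈N⇒≈ₙ {𝓑̂k (- 1#) 1# i} {Λk i} (𝓑̂k-minus1-1≈Λk i)

theorem4p9 : ∀ {c ℓ} (R : CommutativeRing c ℓ) →
    let open CommutativeRing R renaming (Carrier to K) in
    let open NSymOver R in
    (q t : K) →
      -- (a) multiplicativity
      (∀ α β → IsComp α → IsComp β → (𝓑̂ q t α *N 𝓑̂ q t β) ≈N 𝓑̂ q t (α ++ β))
      -- (b) generation (q invertible, as in C(q,t))
      × ((∃ λ u → q * u ≈ 1#) → Generates q t)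
      -- (c) coproduct formula
      × (∀ k → △ (𝓑̂k q t k) ≈T coprodRHS q t k)
      -- specializations
      × (∀ k → 𝓑̂k 1# 0# k ≈N Hk k)
      × (∀ k → 𝓑̂k (- 1#) 1# k ≈N Λk k)
      × (∀ k → △ (Hk k) ≈T sumHH k)
      × (∀ k → △ (Λk k) ≈T sumΛΛ k)
theorem4p9 R q t =
    Basis.𝓑̂-multiplicative R q t
  , Basis.generates R q t
  , Coproduct.△𝓑̂k-formula R q t
  , 𝓑̂k-1-0≈Hk R
  , 𝓑̂k-minus1-1≈Λk R
  , △-Hk R
  , △Λk-formula R
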